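{- Let $n\ge1$ be an integer not divisible by $3$ and let $\Pi$ be a $(3,n)$-Dyck path. Then $\operatorname{area}(\Pi)+\operatorname{skip}(\Pi)+\operatorname{dinv}(\Pi)=n-1$, and $n-1$ equals the number of entries of the rank word.
   Context: A $(3,n)$-Dyck path is a lattice path from $(0,0)$ to $(3,n)$ using unit north and east steps that stays weakly above the line $y=\frac{n}{3}x$. The cell $(a,b)$ ($a\in\{1,2,3\}$ column from left, $b\in\{1,\dots,n\}$ row from bottom) is $[a-1,a]\times[b-1,b]$. $\lambda(\Pi)$ is the set of cells lying above (north-west of) $\Pi$. $\operatorname{area}(\Pi)$ is the number of cells lying entirely below $\Pi$ and above the line $y=\frac n3x$. For $x\in\lambda(\Pi)$, $\operatorname{arm}(x)$ (resp. $\operatorname{leg}(x)$) is the number of cells of $\lambda(\Pi)$ strictly east (resp. strictly south) of $x$ in its row (resp. column). $\operatorname{dinv}(\Pi)$ is the number of $x\in\lambda(\Pi)$ with $\frac{\operatorname{arm}(x)}{\operatorname{leg}(x)+1}<\frac{3}{n}<\frac{\operatorname{arm}(x)+1}{\operatorname{leg}(x)}$ (right side $+\infty$ if $\operatorname{leg}(x)=0$). The rank of cell $(a,b)$ is $-an+3(b-1)$. The rank word (of the lattice) is the list of all positive ranks of cells in increasing order (they lie in columns 1 and 2 and are distinct); the rank word of $\Pi$ is this list with each entry whose cell lies in $\lambda(\Pi)$ marked ("boxed"). A skip of $\Pi$ is a maximal block of consecutive unboxed entries of the rank word having at least one boxed entry somewhere to its left and at least one somewhere to its right; $\operatorname{skip}(\Pi)$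 is the number of skips. -}

module Defs where

open import Data.Nat using (ℕ; zero; suc; _+_; _*_; _∸_; _≤_; _<ᵇ_; _≤ᵇ_; _≡ᵇ_)
open import Data.Bool using (Bool; true; false; _∧_; _∨_; not; if_then_else_)
open import Data.List using (List; []; _∷_; map; concatMap; length; applyUpTo)
open import Data.Bool.ListAction using (any)
open import Data.Product using (_×_; _,_; proj₁; proj₂)
open import Data.Unit using (⊤)
open import Relation.Binary.PropositionalEquality using (_≡_)

data Step : Set where
  N E : Step

countN : List Step → ℕ
countN []       = 0
countN (N ∷ ps) = suc (countN ps)
countN (E ∷ ps) = countN ps

countE : List Step → ℕ
countE []       = 0
countE (N ∷ ps) = countE ps
countE (E ∷ ps) = suc (countE ps)

-- Starting from lattice point (x , y), every lattice point visited by the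
-- path stays weakly above y = (n/3) x, i.e. n * x ≤ 3 * y.  Only east steps
-- can decrease 3y - nx, so it suffices to check after each east step
-- (the start point (0,0) is on the line).
WeaklyAbove : ℕ → ℕ → ℕ → List Step → Set
WeaklyAbove n x y []       = ⊤
WeaklyAbove n x y (N ∷ ps) = WeaklyAbove n x (suc y) ps
WeaklyAbove n x y (E ∷ ps) = (n * suc x ≤ 3 * y) × WeaklyAbove n (suc x) y ps

record IsDyck (n : ℕ) (Π : List Step) : Set where
  field
    numN  : countN Π ≡ n
    numE  : countE Π ≡ 3
    above : WeaklyAbove n 0 0 Π

-- eastHeight Π k = y-coordinate of the (k+1)-st east step of Π (k = 0,1,2).
eastHeight : List Step → ℕ → ℕ
eastHeight []       k       = 0
eastHeight (N ∷ ps) k       = suc (eastHeight ps k)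
eastHeight (E ∷ ps) zero    = 0
eastHeight (E ∷ ps) (suc k) = eastHeight ps k

h : List Step → ℕ → ℕ
h Π a = eastHeight Π (a ∸ 1)

columns : List ℕ
columns = 1 ∷ 2 ∷ 3 ∷ []

rows : ℕ → List ℕ
rows n = applyUpTo suc n

cells : ℕ → List (ℕ × ℕ)
cells n = concatMap (λ a → map (λ b → (a , b)) (rows n)) columns

bfilter : {A : Set} → (A → Bool) → List A → List A
bfilter p []       = []
bfilter p (x ∷ xs) = if p x then x ∷ bfilter p xs else bfilter p xs

count : {A : Set} → (A → Bool) → List A → ℕ
count p []       = 0
count p (x ∷ xs) = (if p x then 1 else 0) + count p xs

-- cell (a , b) = [a-1,a]×[b-1,b] lies in λ(Π) (north-west of Π)
inλ : List Step → ℕ × ℕ → Bool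
inλ Π (a , b) = h Π a <ᵇ b

-- area: cells below Π lying entirely above the line y = (n/3) x,
-- i.e. the lower-right corner (a , b-1) satisfies n*a ≤ 3*(b-1).
area : ℕ → List Step → ℕ
area n Π = count (λ c → not (inλ Π c) ∧ (n * proj₁ c ≤ᵇ 3 * (proj₂ c ∸ 1))) (cells n)

arm : List Step → ℕ × ℕ → ℕ
arm Π (a , b) = count (λ a' → (a <ᵇ a') ∧ inλ Π (a' , b)) columns

-- leg: cells of λ(Π) strictly south in the same column (cells (a,b') with h a < b' < b)
leg : List Step → ℕ × ℕ → ℕ
leg Π (a , b) = b ∸ 1 ∸ h Π a

-- arm/(leg+1) < 3/n < (arm+1)/leg   (right side +∞ when leg = 0),
-- cross-multiplied (n ≥ 1, all denominators positive).
dinvCond : ℕ → ℕ → ℕ → Bool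
dinvCond n ar lg = (n * ar <ᵇ 3 * (lg + 1)) ∧ ((lg ≡ᵇ 0) ∨ (3 * lg <ᵇ n * (ar + 1)))

dinv : ℕ → List Step → ℕ
dinv n Π = count (λ c → inλ Π c ∧ dinvCond n (arm Π c) (leg Π c)) (cells n)

-- rank (a , b) = -a n + 3 (b - 1); it equals the positive number r iff a*n + r = 3*(b-1).
hasRank : ℕ → ℕ → ℕ × ℕ → Bool
hasRank n r (a , b) = a * n + r ≡ᵇ 3 * (b ∸ 1)

cellsOfRank : ℕ → ℕ → List (ℕ × ℕ)
cellsOfRank n r = bfilter (λ c → hasRank n r c) (cells n)

isRank : ℕ → ℕ → Bool
isRank n r = any (hasRank n r) (cells n)

-- candidate positive ranks in increasing order: 1, 2, …, 3n
-- (every rank is < 3n since 3(b-1) ≤ 3n - 3)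
candidates : ℕ → List ℕ
candidates n = applyUpTo suc (3 * n)

rankWordLattice : ℕ → List ℕ
rankWordLattice n = bfilter (λ r → isRank n r) (candidates n)

-- rank word of Π: each entry paired with "boxed" (its cell lies in λ(Π))
rankWord : ℕ → List Step → List (ℕ × Bool)
rankWord n Π = map (λ r → (r , any (inλ Π) (cellsOfRank n r))) (rankWordLattice n)

-- number of skips of a boxed/unboxed word: maximal blocks of unboxed (false)
-- entries with a boxed entry somewhere to the left and to the right.
-- After discarding the leading unboxed entries (no boxed entry to their left),
-- every remaining maximal unboxed block has a boxed entry to its left, and it
-- has one to its right iff it is immediately followed by a boxed entry.
-- So skips = number of "false immediately followed by true" transitions.
closedBlocks : List Bool → ℕ
closedBlocks []                    = 0
closedBlocks (false ∷ true ∷ bs)   = suc (closedBlocks (true ∷ bs))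
closedBlocks (b ∷ bs)              = closedBlocks bs

dropUnboxed : List Bool → List Bool
dropUnboxed []           = []
dropUnboxed (false ∷ bs) = dropUnboxed bs
dropUnboxed (true ∷ bs)  = true ∷ bs

skipWord : List Bool → ℕ
skipWord bs = closedBlocks (dropUnboxed bs)

skip : ℕ → List Step → ℕ
skip n Π = skipWord (map proj₂ (rankWord n Π))

-- Write n = 3m + ρ with ρ ∈ {1, 2}. A (3,n)-Dyck path is given by the heights h₁ ≤ h₂ ≤ h₃ = n of its
-- east steps, and the Dyck condition reads h₁ = m + 1 + q, h₂ = 2m + ρ + p with p ≤ m. Then area = q + p.
-- Every cell of λ has arm 0 or 1, and it counts for dinv iff its leg is at most m (arm 0), resp. lies in
-- [m, 2m] (arm 1), so dinv counts legs in explicit ranges. Modulo 3 the positive rank 3j + i lies in at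
-- most one column, so the rank word has n − 1 entries and interleaves the entries of column 2 (boxed from
-- index p on) with those of column 1 (boxed from index q on); its skips are read off by a left-to-right
-- scan. Comparing q with p and with m leaves three shapes per residue, in each of which the three
-- statistics are explicit and add up to n − 1.

module Submission where

open import Defs
open import Data.Bool using (Bool; true; false; _∧_; _∨_; not; if_then_else_; T)
open import Data.Bool.Properties using (∧-identityʳ; ∨-identityʳ; ∨-zeroʳ)
open import Data.Bool.ListAction using (any)
open import Data.Empty using (⊥-elim)
open import Data.List using (List; []; _∷_; _++_; map; length; concat; concatMap; replicate; applyUpTo)
open import Data.List.Properties using (map-++; map-∘; length-map; length-++; ++-assoc; ++-identityʳ; concat-++)
open import Data.Nat using (ℕ; zero; suc; _+_; _*_; _∸_; _≤_; _<_; _<ᵇ_; _≤ᵇ_; _≡ᵇ_; z≤n; s≤s; z<s; _%_; _/_)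
open import Data.Nat.Properties
open import Data.Nat.DivMod using (m≡m%n+[m/n]*n; m%n<n; [m+kn]%n≡m%n; m*n%n≡0)
open import Data.Nat.Divisibility using (_∣_; m%n≡0⇒n∣m)
open import Data.Nat.Tactic.RingSolver using (solve-∀)
open import Data.Product using (_×_; _,_; proj₂)
open import Data.Sum using (inj₁; inj₂)
open import Data.Unit using (tt)
open import Relation.Nullary using (¬_; yes; no)
open import Relation.Binary.PropositionalEquality

T⇒≡true : ∀ {b} → T b → b ≡ true
T⇒≡true {true} _ = refl

¬T⇒≡false : ∀ {b} → ¬ T b → b ≡ false
¬T⇒≡false {false} _  = refl
¬T⇒≡false {true}  ¬t = ⊥-elim (¬t tt)

<ᵇ-true : ∀ {m n} → m < n → (m <ᵇ n) ≡ true
<ᵇ-true m<n = T⇒≡true (<⇒<ᵇ m<n)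

<ᵇ-false : ∀ {m n} → n ≤ m → (m <ᵇ n) ≡ false
<ᵇ-false {m} {n} n≤m = ¬T⇒≡false (λ t → <⇒≱ (<ᵇ⇒< m n t) n≤m)

≤ᵇ-true : ∀ {m n} → m ≤ n → (m ≤ᵇ n) ≡ true
≤ᵇ-true m≤n = T⇒≡true (≤⇒≤ᵇ m≤n)

≤ᵇ-false : ∀ {m n} → n < m → (m ≤ᵇ n) ≡ false
≤ᵇ-false {m} {n} n<m = ¬T⇒≡false (λ t → <⇒≱ n<m (≤ᵇ⇒≤ m n t))

≡ᵇ-true : ∀ {m n} → m ≡ n → (m ≡ᵇ n) ≡ true
≡ᵇ-true {m} {n} m≡n = T⇒≡true (≡⇒≡ᵇ m n m≡n)

≡ᵇ-false : ∀ {m n} → m ≢ n → (m ≡ᵇ n) ≡ false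
≡ᵇ-false {m} {n} m≢n = ¬T⇒≡false (λ t → m≢n (≡ᵇ⇒≡ m n t))

m+o≡n⇒m≤n : ∀ {m n} o → m + o ≡ n → m ≤ n
m+o≡n⇒m≤n {m} o refl = m≤m+n m o

∧-false : ∀ {x} y → x ≡ false → x ∧ y ≡ false
∧-false y refl = refl

segment : ℕ → ℕ → List ℕ
segment a zero    = []
segment a (suc k) = suc a ∷ segment (suc a) k

applyUpTo≡segment : ∀ k a (f : ℕ → ℕ) → (∀ i → f i ≡ suc (a + i)) → applyUpTo f k ≡ segment a k
applyUpTo≡segment zero    a f f≗ = refl
applyUpTo≡segment (suc k) a f f≗ = cong₂ _∷_ (trans (f≗ 0) (cong suc (+-identityʳ a)))
  (applyUpTo≡segment k (suc a) (λ i → f (suc i)) (λ i → trans (f≗ (suc i)) (cong suc (+-suc a i))))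

rows≡segment : ∀ n → rows n ≡ segment 0 n
rows≡segment n = applyUpTo≡segment n 0 suc (λ _ → refl)

segment-++ : ∀ a k l → segment a (k + l) ≡ segment a k ++ segment (a + k) l
segment-++ a zero    l = cong (λ c → segment c l) (sym (+-identityʳ a))
segment-++ a (suc k) l = cong (suc a ∷_)
  (trans (segment-++ (suc a) k l) (cong (λ c → segment (suc a) k ++ segment c l) (sym (+-suc a k))))

OnSegment : (ℕ → Set) → ℕ → ℕ → Set
OnSegment P a k = ∀ b → a < b → b ≤ a + k → P b

OnSegment-head : ∀ {P a k} → OnSegment P a (suc k) → P (suc a)
OnSegment-head {a = a} {k} all = all (suc a) ≤-refl (≤-trans (s≤s (m≤m+n a k)) (≤-reflexive (sym (+-suc a k))))

OnSegment-tail : ∀ {P a k} → OnSegment P a (suc k) → OnSegment P (suc a) k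
OnSegment-tail {a = a} {k} all b a<b b≤ = all b (<-trans (n<1+n a) a<b) (≤-trans b≤ (≤-reflexive (sym (+-suc a k))))

OnRange : (ℕ → Set) → ℕ → ℕ → Set
OnRange P j k = ∀ i → j ≤ i → i < j + k → P i

OnRange-head : ∀ {P j k} → OnRange P j (suc k) → P j
OnRange-head {j = j} all = all j ≤-refl (m<m+n j z<s)

OnRange-tail : ∀ {P j k} → OnRange P j (suc k) → OnRange P (suc j) k
OnRange-tail {j = j} {k} all i j<i i< = all i (<⇒≤ j<i) (≤-trans i< (≤-reflexive (sym (+-suc j k))))

ConstantOn : {A : Set} → (ℕ → A) → ℕ → ℕ → A → Set
ConstantOn f j k u = OnRange (λ i → f i ≡ u) j k

module _ {A : Set} where

  count-++ : ∀ (f : A → Bool) xs ys → count f (xs ++ ys) ≡ count f xs + count f ys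
  count-++ f []       ys = refl
  count-++ f (x ∷ xs) ys =
    trans (cong ((if f x then 1 else 0) +_) (count-++ f xs ys)) (sym (+-assoc (if f x then 1 else 0) _ _))

  any-++ : ∀ (f : A → Bool) xs ys → any f (xs ++ ys) ≡ any f xs ∨ any f ys
  any-++ f []       ys = refl
  any-++ f (x ∷ xs) ys rewrite any-++ f xs ys with f x
  ... | true  = refl
  ... | false = refl

  any-cong : ∀ {f g : A → Bool} xs → (∀ x → f x ≡ g x) → any f xs ≡ any g xs
  any-cong []       f≗g = refl
  any-cong (x ∷ xs) f≗g = cong₂ _∨_ (f≗g x) (any-cong xs f≗g)

  any-bfilter : ∀ (f p : A → Bool) xs → any f (bfilter p xs) ≡ any (λ x → p x ∧ f x) xs
  any-bfilter f p []       = refl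
  any-bfilter f p (x ∷ xs) with p x
  ... | true  = cong (f x ∨_) (any-bfilter f p xs)
  ... | false = any-bfilter f p xs

  map-bfilter : ∀ {B : Set} (f : A → B) (p : A → Bool) xs →
    map f (bfilter p xs) ≡ concatMap (λ x → if p x then f x ∷ [] else []) xs
  map-bfilter f p []       = refl
  map-bfilter f p (x ∷ xs) with p x
  ... | true  = cong (f x ∷_) (map-bfilter f p xs)
  ... | false = map-bfilter f p xs

  module _ {B : Set} where

    count-map : ∀ (f : B → Bool) (g : A → B) xs → count f (map g xs) ≡ count (λ x → f (g x)) xs
    count-map f g []       = refl
    count-map f g (x ∷ xs) = cong ((if f (g x) then 1 else 0) +_) (count-map f g xs)

    any-map : ∀ (f : B → Bool) (g : A → B) xs → any f (map g xs) ≡ any (λ x → f (g x)) xs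
    any-map f g []       = refl
    any-map f g (x ∷ xs) = cong (f (g x) ∨_) (any-map f g xs)

    concatMap-++ : ∀ (f : A → List B) xs ys → concatMap f (xs ++ ys) ≡ concatMap f xs ++ concatMap f ys
    concatMap-++ f xs ys = trans (cong concat (map-++ f xs ys)) (sym (concat-++ (map f xs) (map f ys)))

++-assoc₄ : ∀ {A : Set} (a b c d : List A) → (a ++ (b ++ c)) ++ d ≡ a ++ (b ++ (c ++ d))
++-assoc₄ a b c d = trans (++-assoc a (b ++ c) d) (cong (a ++_) (++-assoc b c d))

count-segment-cong : ∀ {f g : ℕ → Bool} a k → OnSegment (λ b → f b ≡ g b) a k →
  count f (segment a k) ≡ count g (segment a k)
count-segment-cong a zero    f≗g = refl
count-segment-cong a (suc k) f≗g =
  cong₂ (λ x c → (if x then 1 else 0) + c) (OnSegment-head f≗g) (count-segment-cong (suc a) k (OnSegment-tail f≗g))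

count-segment-all : ∀ {f : ℕ → Bool} a k → OnSegment (λ b → f b ≡ true) a k → count f (segment a k) ≡ k
count-segment-all a zero    f≡true = refl
count-segment-all a (suc k) f≡true rewrite OnSegment-head f≡true = cong suc (count-segment-all (suc a) k (OnSegment-tail f≡true))

count-segment-none : ∀ {f : ℕ → Bool} a k → OnSegment (λ b → f b ≡ false) a k → count f (segment a k) ≡ 0
count-segment-none a zero    f≡false = refl
count-segment-none a (suc k) f≡false rewrite OnSegment-head f≡false = count-segment-none (suc a) k (OnSegment-tail f≡false)

count-segment-shift : ∀ (f : ℕ → Bool) a c k → count f (segment (a + c) k) ≡ count (λ b → f (a + b)) (segment c k)
count-segment-shift f a c zero    = refl
count-segment-shift f a c (suc k) rewrite sym (+-suc a c) =
  cong ((if f (a + suc c) then 1 else 0) +_) (count-segment-shift f a (suc c) k)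

count-segment-split : ∀ (f : ℕ → Bool) a k l →
  count f (segment a (k + l)) ≡ count f (segment a k) + count f (segment (a + k) l)
count-segment-split f a k l = trans (cong (count f) (segment-++ a k l)) (count-++ f (segment a k) _)

any-segment-none : ∀ {f : ℕ → Bool} a k → OnSegment (λ b → f b ≡ false) a k → any f (segment a k) ≡ false
any-segment-none a zero    f≡false = refl
any-segment-none a (suc k) f≡false rewrite OnSegment-head f≡false = any-segment-none (suc a) k (OnSegment-tail f≡false)

any-segment-unique : ∀ {f : ℕ → Bool} a k c → a < c → c ≤ a + k →
  OnSegment (λ b → b ≢ c → f b ≡ false) a k → any f (segment a k) ≡ f c
any-segment-unique a zero    c a<c c≤a+0 others = ⊥-elim (<⇒≱ a<c (≤-trans c≤a+0 (≤-reflexive (+-identityʳ a))))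
any-segment-unique {f} a (suc k) c a<c c≤ others with suc a ≟ c
... | yes refl = trans (cong (f (suc a) ∨_) (any-segment-none (suc a) k (λ b a<b b≤ → OnSegment-tail others b a<b b≤ (>⇒≢ a<b))))
                       (∨-identityʳ _)
... | no a+1≢c rewrite OnSegment-head others a+1≢c =
  any-segment-unique (suc a) k c (≤∧≢⇒< a<c a+1≢c) (≤-trans c≤ (≤-reflexive (+-suc a k))) (OnSegment-tail others)

module _ {A : Set} where

  blocks : (ℕ → List A) → ℕ → ℕ → List A
  blocks B j zero    = []
  blocks B j (suc k) = B j ++ blocks B (suc j) k

  blocks-++ : ∀ B j k l → blocks B j (k + l) ≡ blocks B j k ++ blocks B (j + k) l
  blocks-++ B j zero    l = cong (λ i → blocks B i l) (sym (+-identityʳ j))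
  blocks-++ B j (suc k) l = trans (cong (B j ++_) (blocks-++ B (suc j) k l))
    (trans (sym (++-assoc (B j) _ _)) (cong (λ i → (B j ++ blocks B (suc j) k) ++ blocks B i l) (sym (+-suc j k))))

  blocks-++₃ : ∀ B j k l o → blocks B j (k + (l + o)) ≡ blocks B j k ++ (blocks B (j + k) l ++ blocks B (j + k + l) o)
  blocks-++₃ B j k l o = trans (blocks-++ B j k (l + o)) (cong (blocks B j k ++_) (blocks-++ B (j + k) l o))

  blocks-nil : ∀ {B : ℕ → List A} j k → ConstantOn B j k [] → blocks B j k ≡ []
  blocks-nil j zero    B≡[] = refl
  blocks-nil j (suc k) B≡[] rewrite OnRange-head B≡[] = blocks-nil (suc j) k (OnRange-tail B≡[])

  blocks-cong : ∀ {B C : ℕ → List A} j k → OnRange (λ i → B i ≡ C i) j k → blocks B j k ≡ blocks C j k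
  blocks-cong j zero    B≗C = refl
  blocks-cong j (suc k) B≗C = cong₂ _++_ (OnRange-head B≗C) (blocks-cong (suc j) k (OnRange-tail B≗C))

  blocks-const : ∀ {B : ℕ → List A} w j k → ConstantOn B j k w → blocks B j k ≡ concat (replicate k w)
  blocks-const w j zero    B≡w = refl
  blocks-const w j (suc k) B≡w = cong₂ _++_ (OnRange-head B≡w) (blocks-const w (suc j) k (OnRange-tail B≡w))

  length-blocks : ∀ {B : ℕ → List A} c j k → (∀ i → length (B i) ≡ c) → length (blocks B j k) ≡ k * c
  length-blocks {B} c j zero    _    = refl
  length-blocks {B} c j (suc k) |B|≡c =
    trans (length-++ (B j)) (cong₂ _+_ (|B|≡c j) (length-blocks c (suc j) k |B|≡c))

  concatMap-segment-blocks : ∀ (e : ℕ → List A) j k →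
    concatMap e (segment (3 * j) (3 * k)) ≡ blocks (λ i → concatMap e (segment (3 * i) 3)) j k
  concatMap-segment-blocks e j zero    = cong (λ l → concatMap e (segment (3 * j) l)) (*-zeroʳ 3)
  concatMap-segment-blocks e j (suc k) = begin
      concatMap e (segment (3 * j) (3 * suc k))
    ≡⟨ cong (concatMap e) (trans (cong (segment (3 * j)) (*-suc 3 k)) (segment-++ (3 * j) 3 (3 * k))) ⟩
      concatMap e (segment (3 * j) 3 ++ segment (3 * j + 3) (3 * k))
    ≡⟨ concatMap-++ e (segment (3 * j) 3) (segment (3 * j + 3) (3 * k)) ⟩
      concatMap e (segment (3 * j) 3) ++ concatMap e (segment (3 * j + 3) (3 * k))
    ≡⟨ cong (λ a → concatMap e (segment (3 * j) 3) ++ concatMap e (segment a (3 * k)))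
            (trans (+-comm (3 * j) 3) (sym (*-suc 3 j))) ⟩
      concatMap e (segment (3 * j) 3) ++ concatMap e (segment (3 * suc j) (3 * k))
    ≡⟨ cong (concatMap e (segment (3 * j) 3) ++_) (concatMap-segment-blocks e (suc j) k) ⟩
      blocks (λ i → concatMap e (segment (3 * i) 3)) j (suc k)
    ∎
    where open ≡-Reasoning

count-cells : ∀ (P : ℕ × ℕ → Bool) n → count P (cells n) ≡
  count (λ b → P (1 , b)) (rows n) + (count (λ b → P (2 , b)) (rows n) + (count (λ b → P (3 , b)) (rows n) + 0))
count-cells P n =
  trans (count-++ P (map (1 ,_) (rows n)) _) (cong₂ _+_ (count-map P _ (rows n))
    (trans (count-++ P (map (2 ,_) (rows n)) _) (cong₂ _+_ (count-map P _ (rows n))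
      (trans (count-++ P (map (3 ,_) (rows n)) _) (cong₂ _+_ (count-map P _ (rows n)) refl)))))

any-cells : ∀ (P : ℕ × ℕ → Bool) n → any P (cells n) ≡
  any (λ b → P (1 , b)) (rows n) ∨ (any (λ b → P (2 , b)) (rows n) ∨ (any (λ b → P (3 , b)) (rows n) ∨ false))
any-cells P n =
  trans (any-++ P (map (1 ,_) (rows n)) _) (cong₂ _∨_ (any-map P _ (rows n))
    (trans (any-++ P (map (2 ,_) (rows n)) _) (cong₂ _∨_ (any-map P _ (rows n))
      (trans (any-++ P (map (3 ,_) (rows n)) _) (cong₂ _∨_ (any-map P _ (rows n)) refl)))))

-- Heights of a Dyck path

eastHeight-above : ∀ n x y ps k → WeaklyAbove n x y ps → k < countE ps → n * (x + suc k) ≤ 3 * (y + eastHeight ps k)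
eastHeight-above n x y (N ∷ ps) k above k< =
  ≤-trans (eastHeight-above n x (suc y) ps k above k<) (≤-reflexive (cong (3 *_) (sym (+-suc y (eastHeight ps k)))))
eastHeight-above n x y (E ∷ ps) zero (here , _) _ =
  ≤-trans (≤-reflexive (cong (n *_) (+-comm x 1))) (≤-trans here (≤-reflexive (cong (3 *_) (sym (+-identityʳ y)))))
eastHeight-above n x y (E ∷ ps) (suc k) (_ , above) (s≤s k<) =
  ≤-trans (≤-reflexive (cong (n *_) (+-suc x (suc k)))) (eastHeight-above n (suc x) y ps k above k<)

eastHeight-mono : ∀ ps k → eastHeight ps k ≤ eastHeight ps (suc k)
eastHeight-mono []       k       = z≤n
eastHeight-mono (N ∷ ps) k       = s≤s (eastHeight-mono ps k)
eastHeight-mono (E ∷ ps) zero    = z≤n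
eastHeight-mono (E ∷ ps) (suc k) = eastHeight-mono ps k

eastHeight≤countN : ∀ ps k → eastHeight ps k ≤ countN ps
eastHeight≤countN []       k       = z≤n
eastHeight≤countN (N ∷ ps) k       = s≤s (eastHeight≤countN ps k)
eastHeight≤countN (E ∷ ps) zero    = z≤n
eastHeight≤countN (E ∷ ps) (suc k) = eastHeight≤countN ps k

module Dyck {n Π} (dyck : IsDyck n Π) where
  open IsDyck dyck using (numN; numE)

  column-above : ∀ a → 0 < a → a ≤ 3 → n * a ≤ 3 * h Π a
  column-above (suc k) _ a≤3 = eastHeight-above n 0 0 Π k (IsDyck.above dyck) (subst (k <_) (sym numE) a≤3)

  h₁≤h₂ : h Π 1 ≤ h Π 2
  h₁≤h₂ = eastHeight-mono Π 0

  h₃≡n : h Π 3 ≡ n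
  h₃≡n = ≤-antisym (subst (h Π 3 ≤_) numN (eastHeight≤countN Π 2))
    (*-cancelˡ-≤ 3 (≤-trans (≤-reflexive (*-comm 3 n)) (column-above 3 z<s ≤-refl)))

  h₂≤n : h Π 2 ≤ n
  h₂≤n = ≤-trans (eastHeight-mono Π 1) (≤-reflexive h₃≡n)

  h₁≤n : h Π 1 ≤ n
  h₁≤n = ≤-trans h₁≤h₂ h₂≤n

-- Area and dinv, column by column

-- With c = ⌈K / 3⌉ the counted rows are c + 1, …, c + q.
area-column : ∀ {K c h q NN} → K ≤ 3 * c → 3 * c < 3 + K → h ≡ c + q → h ≤ NN →
  count (λ b → not (h <ᵇ b) ∧ (K ≤ᵇ 3 * (b ∸ 1))) (rows NN) ≡ q
area-column {K} {c} {h} {q} {NN} K≤3c 3c<3+K refl h≤NN = begin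
    count f (rows NN)
  ≡⟨ cong (count f) (trans (rows≡segment NN) (cong (segment 0) NN≡c+[q+r])) ⟩
    count f (segment 0 (c + (q + r)))
  ≡⟨ count-segment-split f 0 c (q + r) ⟩
    count f (segment 0 c) + count f (segment c (q + r))
  ≡⟨ cong (count f (segment 0 c) +_) (count-segment-split f c q r) ⟩
    count f (segment 0 c) + (count f (segment c q) + count f (segment (c + q) r))
  ≡⟨ cong₂ _+_ (count-segment-none 0 c below) (cong₂ _+_ (count-segment-all c q inside) (count-segment-none (c + q) r beyond)) ⟩
    0 + (q + 0)
  ≡⟨ +-identityʳ q ⟩
    q
  ∎
  where
  open ≡-Reasoning
  f : ℕ → Bool
  f b = not (c + q <ᵇ b) ∧ (K ≤ᵇ 3 * (b ∸ 1))
  r : ℕ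
  r = NN ∸ (c + q)
  NN≡c+[q+r] : NN ≡ c + (q + r)
  NN≡c+[q+r] = trans (sym (m+[n∸m]≡n h≤NN)) (+-assoc c q r)
  below : ∀ b → 0 < b → b ≤ 0 + c → f b ≡ false
  below (suc x) _ x<c rewrite <ᵇ-false {c + q} {suc x} (≤-trans x<c (m≤m+n c q)) =
    ≤ᵇ-false (+-cancelˡ-< 3 (3 * x) K (≤-<-trans (≤-trans (≤-reflexive (sym (*-suc 3 x))) (*-monoʳ-≤ 3 x<c)) 3c<3+K))
  inside : ∀ b → c < b → b ≤ c + q → f b ≡ true
  inside (suc x) (s≤s c≤x) b≤h rewrite <ᵇ-false {c + q} {suc x} b≤h = ≤ᵇ-true (≤-trans K≤3c (*-monoʳ-≤ 3 c≤x))
  beyond : ∀ b → c + q < b → b ≤ c + q + r → f b ≡ false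
  beyond b h<b _ rewrite <ᵇ-true h<b = refl

area≡ : ∀ {n Π c₁ q c₂ p} → IsDyck n Π →
  n * 1 ≤ 3 * c₁ → 3 * c₁ < 3 + n * 1 → h Π 1 ≡ c₁ + q →
  n * 2 ≤ 3 * c₂ → 3 * c₂ < 3 + n * 2 → h Π 2 ≡ c₂ + p →
  area n Π ≡ q + p
area≡ {n} {Π} {c₁} {q} {c₂} {p} dyck lo₁ hi₁ h₁≡ lo₂ hi₂ h₂≡ = begin
    area n Π
  ≡⟨ count-cells _ n ⟩
    column 1 + (column 2 + (column 3 + 0))
  ≡⟨ cong₂ _+_ (area-column {c = c₁} {q = q} lo₁ hi₁ h₁≡ h₁≤n) (cong₂ _+_ (area-column {c = c₂} {q = p} lo₂ hi₂ h₂≡ h₂≤n)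
       (cong (_+ 0) (area-column {c = n} {q = 0} (≤-reflexive (*-comm n 3)) (≤-trans (≤-reflexive (cong suc (*-comm 3 n))) (m≤n+m _ 2))
                                 (trans h₃≡n (sym (+-identityʳ n))) (≤-reflexive h₃≡n)))) ⟩
    q + (p + (0 + 0))
  ≡⟨ cong (q +_) (+-identityʳ p) ⟩
    q + p
  ∎
  where
  open ≡-Reasoning
  open Dyck dyck
  column : ℕ → ℕ
  column a = count (λ b → not (h Π a <ᵇ b) ∧ (n * a ≤ᵇ 3 * (b ∸ 1))) (rows n)

legCount : (ℕ → Bool) → ℕ → ℕ → ℕ
legCount f s k = count (λ b → f (b ∸ 1)) (segment s k)

legCount-split : ∀ f s k l → legCount f s (k + l) ≡ legCount f s k + legCount f (s + k) l
legCount-split f s k l = count-segment-split (λ b → f (b ∸ 1)) s k l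

legCount-all : ∀ {f} s k → OnRange (λ l → f l ≡ true) s k → legCount f s k ≡ k
legCount-all s k f≡true = count-segment-all s k (λ { (suc l) s<b b≤ → f≡true l (≤-pred s<b) b≤ })

legCount-none : ∀ {f} s k → OnRange (λ l → f l ≡ false) s k → legCount f s k ≡ 0
legCount-none s k f≡false = count-segment-none s k (λ { (suc l) s<b b≤ → f≡false l (≤-pred s<b) b≤ })

count-above-height : ∀ (g : ℕ → ℕ → Bool) H k →
  count (λ b → (H <ᵇ b) ∧ g b (b ∸ 1 ∸ H)) (rows (H + k)) ≡ count (λ b → g (H + b) (b ∸ 1)) (segment 0 k)
count-above-height g H k = begin
    count f (rows (H + k))
  ≡⟨ trans (cong (count f) (rows≡segment (H + k))) (count-segment-split f 0 H k) ⟩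
    count f (segment 0 H) + count f (segment H k)
  ≡⟨ cong₂ _+_ (count-segment-none 0 H (λ b _ b≤H → ∧-false _ (<ᵇ-false b≤H)))
               (trans (cong (λ a → count f (segment a k)) (sym (+-identityʳ H))) (count-segment-shift f H 0 k)) ⟩
    count (λ b → f (H + b)) (segment 0 k)
  ≡⟨ count-segment-cong 0 k above ⟩
    count (λ b → g (H + b) (b ∸ 1)) (segment 0 k)
  ∎
  where
  open ≡-Reasoning
  f : ℕ → Bool
  f b = (H <ᵇ b) ∧ g b (b ∸ 1 ∸ H)
  above : ∀ b → 0 < b → b ≤ k → f (H + b) ≡ g (H + b) (b ∸ 1)
  above (suc l) _ _ rewrite <ᵇ-true (m<m+n H (z<s {l})) | +-suc H l = cong (g (suc (H + l))) (m+n∸m≡n H l)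

-- The column-1 summand of dinv with arm and leg unfolded: cells up to row h₂ have arm 0, the others arm 1.
dinv-column₁ : ∀ n h₁ h₂ h₃ A r NN → h₂ ≡ h₁ + A → NN ≡ h₁ + (A + r) → NN ≤ h₃ →
  count (λ b → (h₁ <ᵇ b) ∧ dinvCond n (0 + ((if h₂ <ᵇ b then 1 else 0) + ((if h₃ <ᵇ b then 1 else 0) + 0))) (b ∸ 1 ∸ h₁))
        (rows NN)
  ≡ legCount (dinvCond n 0) 0 A + legCount (dinvCond n 1) A r
dinv-column₁ n h₁ _ h₃ A r _ refl refl NN≤h₃ = begin
    count (λ b → (h₁ <ᵇ b) ∧ dinvCond n (armOf b) (b ∸ 1 ∸ h₁)) (rows (h₁ + (A + r)))
  ≡⟨ count-above-height (λ b → dinvCond n (armOf b)) h₁ (A + r) ⟩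
    count g (segment 0 (A + r))
  ≡⟨ count-segment-split g 0 A r ⟩
    count g (segment 0 A) + count g (segment A r)
  ≡⟨ cong₂ _+_ (count-segment-cong 0 A armZero) (count-segment-cong A r armOne) ⟩
    legCount (dinvCond n 0) 0 A + legCount (dinvCond n 1) A r
  ∎
  where
  open ≡-Reasoning
  armOf : ℕ → ℕ
  armOf b = 0 + ((if h₁ + A <ᵇ b then 1 else 0) + ((if h₃ <ᵇ b then 1 else 0) + 0))
  g : ℕ → Bool
  g b = dinvCond n (armOf (h₁ + b)) (b ∸ 1)
  below-h₃ : ∀ {b} → b ≤ A + r → (h₃ <ᵇ h₁ + b) ≡ false
  below-h₃ b≤ = <ᵇ-false (≤-trans (+-monoʳ-≤ h₁ b≤) NN≤h₃)
  armZero : ∀ b → 0 < b → b ≤ A → g b ≡ dinvCond n 0 (b ∸ 1)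
  armZero b _ b≤A rewrite <ᵇ-false (+-monoʳ-≤ h₁ b≤A) | below-h₃ (≤-trans b≤A (m≤m+n A r)) = refl
  armOne : ∀ b → A < b → b ≤ A + r → g b ≡ dinvCond n 1 (b ∸ 1)
  armOne b A<b b≤ rewrite <ᵇ-true (+-monoʳ-< h₁ A<b) | below-h₃ b≤ = refl

dinv-column₂ : ∀ n h₂ h₃ r NN → NN ≡ h₂ + r → NN ≤ h₃ →
  count (λ b → (h₂ <ᵇ b) ∧ dinvCond n (0 + (0 + ((if h₃ <ᵇ b then 1 else 0) + 0))) (b ∸ 1 ∸ h₂)) (rows NN)
  ≡ legCount (dinvCond n 0) 0 r
dinv-column₂ n h₂ h₃ r _ refl NN≤h₃ =
  trans (count-above-height (λ b → dinvCond n (0 + (0 + ((if h₃ <ᵇ b then 1 else 0) + 0)))) h₂ r)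
        (count-segment-cong 0 r (λ b _ b≤r → cong (λ x → dinvCond n (0 + (0 + ((if x then 1 else 0) + 0))) (b ∸ 1))
                                                   (<ᵇ-false (≤-trans (+-monoʳ-≤ h₂ b≤r) NN≤h₃))))

dinv-column₃ : ∀ n h₃ → n ≤ h₃ →
  count (λ b → (h₃ <ᵇ b) ∧ dinvCond n 0 (b ∸ 1 ∸ h₃)) (rows n) ≡ 0
dinv-column₃ n h₃ n≤h₃ =
  trans (cong (count _) (rows≡segment n)) (count-segment-none 0 n (λ b _ b≤n → ∧-false _ (<ᵇ-false (≤-trans b≤n n≤h₃))))

dinv≡ : ∀ {n Π A r} → IsDyck n Π → h Π 2 ≡ h Π 1 + A → n ≡ h Π 2 + r →
  dinv n Π ≡ (legCount (dinvCond n 0) 0 A + legCount (dinvCond n 1) A r) + legCount (dinvCond n 0) 0 r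
dinv≡ {n} {Π} {A} {r} dyck h₂≡ n≡ = begin
    dinv n Π
  ≡⟨ count-cells _ n ⟩
    _
  ≡⟨ cong₂ _+_ (dinv-column₁ n (h Π 1) (h Π 2) (h Π 3) A r n h₂≡ n≡h₁+[A+r] n≤h₃)
       (cong₂ _+_ (dinv-column₂ n (h Π 2) (h Π 3) r n n≡ n≤h₃) (cong (_+ 0) (dinv-column₃ n (h Π 3) n≤h₃))) ⟩
    (legCount (dinvCond n 0) 0 A + legCount (dinvCond n 1) A r) + (legCount (dinvCond n 0) 0 r + (0 + 0))
  ≡⟨ cong ((legCount (dinvCond n 0) 0 A + legCount (dinvCond n 1) A r) +_) (+-identityʳ _) ⟩
    (legCount (dinvCond n 0) 0 A + legCount (dinvCond n 1) A r) + legCount (dinvCond n 0) 0 r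
  ∎
  where
  open ≡-Reasoning
  open Dyck dyck
  n≤h₃ : n ≤ h Π 3
  n≤h₃ = ≤-reflexive (sym h₃≡n)
  n≡h₁+[A+r] : n ≡ h Π 1 + (A + r)
  n≡h₁+[A+r] = trans n≡ (trans (cong (_+ r) h₂≡) (+-assoc (h Π 1) A r))

module Legs {n m : ℕ} (lower : 3 * m < n) (upper : n < 3 * suc m) where

  armZero-true : ∀ {l} → l ≤ m → dinvCond n 0 l ≡ true
  armZero-true {l} l≤m rewrite *-zeroʳ n | *-identityʳ n
    | <ᵇ-true {0} {3 * (l + 1)} (≤-trans (s≤s z≤n) (≤-reflexive (sym (trans (*-distribˡ-+ 3 l 1) (+-comm (3 * l) 3)))))
    | <ᵇ-true (≤-<-trans (*-monoʳ-≤ 3 l≤m) lower) = ∨-zeroʳ _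

  armZero-false : ∀ {l} → m < l → dinvCond n 0 l ≡ false
  armZero-false {suc l} m<l rewrite *-zeroʳ n | *-identityʳ n
    | <ᵇ-false {3 * suc l} {n} (≤-trans (<⇒≤ upper) (*-monoʳ-≤ 3 m<l)) = refl

  three-l<two-n : ∀ {l} → l ≤ 2 * m → 3 * l < n * 2
  three-l<two-n {l} l≤2m = begin-strict
      3 * l         ≤⟨ *-monoʳ-≤ 3 l≤2m ⟩
      3 * (2 * m)   ≡⟨ six-m m ⟩
      3 * m + 3 * m <⟨ +-mono-<-≤ lower (<⇒≤ lower) ⟩
      n + n         ≡⟨ sym (trans (*-comm n 2) (cong (n +_) (+-identityʳ n))) ⟩
      n * 2         ∎
    where
    open ≤-Reasoning
    six-m : ∀ m → 3 * (2 * m) ≡ 3 * m + 3 * m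
    six-m = solve-∀

  armOne-true : ∀ {l} → m ≤ l → l ≤ 2 * m → dinvCond n 1 l ≡ true
  armOne-true {l} m≤l l≤2m rewrite *-identityʳ n
    | <ᵇ-true {n} {3 * (l + 1)} (≤-trans upper (*-monoʳ-≤ 3 (≤-trans (s≤s m≤l) (≤-reflexive (+-comm 1 l)))))
    | <ᵇ-true (three-l<two-n l≤2m) = ∨-zeroʳ _

  armOne-false : ∀ {l} → l < m → dinvCond n 1 l ≡ false
  armOne-false {l} l<m rewrite *-identityʳ n
    | <ᵇ-false {n} {3 * (l + 1)} (≤-trans (*-monoʳ-≤ 3 (≤-trans (≤-reflexive (+-comm l 1)) l<m)) (<⇒≤ lower)) = refl

  armZero-legs : ∀ k → k ≤ suc m → legCount (dinvCond n 0) 0 k ≡ k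
  armZero-legs k k≤ = legCount-all 0 k (λ l _ l<k → armZero-true (≤-pred (≤-trans l<k k≤)))

  armZero-legs-capped : ∀ d → legCount (dinvCond n 0) 0 (suc m + d) ≡ suc m
  armZero-legs-capped d = begin
      legCount (dinvCond n 0) 0 (suc m + d)
    ≡⟨ legCount-split (dinvCond n 0) 0 (suc m) d ⟩
      legCount (dinvCond n 0) 0 (suc m) + legCount (dinvCond n 0) (suc m) d
    ≡⟨ cong₂ _+_ (armZero-legs (suc m) ≤-refl) (legCount-none (suc m) d (λ l m<l _ → armZero-false m<l)) ⟩
      suc m + 0
    ≡⟨ +-identityʳ (suc m) ⟩
      suc m
    ∎
    where open ≡-Reasoning

  armOne-legs : ∀ s k → m ≤ s → s + k ≤ suc (2 * m) → legCount (dinvCond n 1) s k ≡ k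
  armOne-legs s k m≤s s+k≤ = legCount-all s k (λ l s≤l l< → armOne-true (≤-trans m≤s s≤l) (≤-pred (≤-trans l< s+k≤)))

  armOne-legs-none : ∀ s k → s + k ≤ m → legCount (dinvCond n 1) s k ≡ 0
  armOne-legs-none s k s+k≤m = legCount-none s k (λ l _ l< → armOne-false (<-≤-trans l< s+k≤m))

  armOne-legs-from : ∀ s d r → s + d ≡ m → m + r ≤ suc (2 * m) → legCount (dinvCond n 1) s (d + r) ≡ r
  armOne-legs-from s d r s+d≡m m+r≤ = begin
      legCount (dinvCond n 1) s (d + r)
    ≡⟨ legCount-split (dinvCond n 1) s d r ⟩
      legCount (dinvCond n 1) s d + legCount (dinvCond n 1) (s + d) r
    ≡⟨ cong₂ _+_ (armOne-legs-none s d (≤-reflexive s+d≡m))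
                 (armOne-legs (s + d) r (≤-reflexive (sym s+d≡m)) (subst (λ x → x + r ≤ suc (2 * m)) (sym s+d≡m) m+r≤)) ⟩
      r
    ∎
    where open ≡-Reasoning

-- Skips

-- skipWord as a left-to-right scan: a skip is counted when a boxed entry ends a gap, an unboxed block
-- that follows a boxed entry.
data Phase : Set where
  leading : Phase
  boxed   : Phase
  gap     : Phase

next : Phase → Bool → Phase
next _       true  = boxed
next leading false = leading
next boxed   false = gap
next gap     false = gap

closes : Phase → Bool → ℕ
closes gap true = 1
closes _   _    = 0

skipsFrom : Phase → List Bool → ℕ
skipsFrom s []       = 0
skipsFrom s (b ∷ bs) = closes s b + skipsFrom (next s b) bs

phaseAfter : Phase → List Bool → Phase
phaseAfter s []       = s
phaseAfter s (b ∷ bs) = phaseAfter (next s b) bs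

closedBlocks-boxed : ∀ bs → closedBlocks (true ∷ bs) ≡ skipsFrom boxed bs
closedBlocks-gap   : ∀ bs → closedBlocks (false ∷ bs) ≡ skipsFrom gap bs
closedBlocks-boxed []           = refl
closedBlocks-boxed (true ∷ bs)  = closedBlocks-boxed bs
closedBlocks-boxed (false ∷ bs) = closedBlocks-gap bs
closedBlocks-gap []           = refl
closedBlocks-gap (true ∷ bs)  = cong suc (closedBlocks-boxed bs)
closedBlocks-gap (false ∷ bs) = closedBlocks-gap bs

skipWord≡skipsFrom : ∀ bs → skipWord bs ≡ skipsFrom leading bs
skipWord≡skipsFrom []           = refl
skipWord≡skipsFrom (false ∷ bs) = skipWord≡skipsFrom bs
skipWord≡skipsFrom (true ∷ bs)  = closedBlocks-boxed bs

record Reads (s : Phase) (w : List Bool) (k : ℕ) (s′ : Phase) : Set where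
  field
    skips : skipsFrom s w ≡ k
    ends  : phaseAfter s w ≡ s′

reads : ∀ s w → Reads s w (skipsFrom s w) (phaseAfter s w)
reads s w = record { skips = refl ; ends = refl }

reads-++ : ∀ {s w k s′ w′ k′ s″} → Reads s w k s′ → Reads s′ w′ k′ s″ → Reads s (w ++ w′) (k + k′) s″
reads-++ {s} {w} {w′ = w′} record { skips = refl ; ends = refl } record { skips = refl ; ends = refl } =
  record { skips = split s w ; ends = ends s w }
  where
  split : ∀ s w → skipsFrom s (w ++ w′) ≡ skipsFrom s w + skipsFrom (phaseAfter s w) w′
  split s []       = refl
  split s (b ∷ bs) = trans (cong (closes s b +_) (split (next s b) bs)) (sym (+-assoc (closes s b) _ _))
  ends : ∀ s w → phaseAfter s (w ++ w′) ≡ phaseAfter (phaseAfter s w) w′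
  ends s []       = refl
  ends s (b ∷ bs) = ends (next s b) bs

pattern □  = false ∷ []
pattern ■  = true ∷ []
pattern □□ = false ∷ false ∷ []
pattern □■ = false ∷ true ∷ []
pattern ■□ = true ∷ false ∷ []
pattern ■■ = true ∷ true ∷ []

run : ℕ → List Bool → List Bool
run k w = concat (replicate k w)

reads-replicate : ∀ {s w k} → Reads s w k s → ∀ j → Reads s (run j w) (j * k) s
reads-replicate {s} {w} {k} loop zero    = reads s []
reads-replicate {s} {w} {k} loop (suc j) = reads-++ loop (reads-replicate loop j)

reads-enter : ∀ {s w k s′ k′} → Reads s w k s′ → Reads s′ w k′ s′ → ∀ j → Reads s (run (suc j) w) (k + j * k′) s′
reads-enter first loop j = reads-++ first (reads-replicate loop j)

reads-then : ∀ {s w k s′ w′ k′} → Reads s w k s′ → skipsFrom s′ w′ ≡ k′ → skipsFrom s (w ++ w′) ≡ k + k′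
reads-then reading refl = Reads.skips (reads-++ reading (reads _ _))

trueRun : ℕ → ℕ → List Bool
trueRun r k = run r ■■ ++ run k ■

trueRun-boxed : ∀ r k → skipsFrom boxed (trueRun r k) ≡ 0
trueRun-boxed (suc r) k       = trueRun-boxed r k
trueRun-boxed zero    (suc k) = trueRun-boxed zero k
trueRun-boxed zero    zero    = refl

trueRun-leading : ∀ r k → skipsFrom leading (trueRun r k) ≡ 0
trueRun-leading (suc r) k       = trueRun-boxed r k
trueRun-leading zero    (suc k) = trueRun-boxed zero k
trueRun-leading zero    zero    = refl

trueRun-gap : ∀ r k → 0 < r + k → skipsFrom gap (trueRun r k) ≡ 1
trueRun-gap (suc r) k       _ = cong suc (trueRun-boxed r k)
trueRun-gap zero    (suc k) _ = cong suc (trueRun-boxed zero k)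

skips-□■ : ∀ a d r k → skipsFrom leading ((run a □□ ++ (run (suc d) □■ ++ run r ■■)) ++ run k ■) ≡ d
skips-□■ a d r k = begin
    skipsFrom leading ((run a □□ ++ (run (suc d) □■ ++ run r ■■)) ++ run k ■)
  ≡⟨ cong (skipsFrom leading) (++-assoc₄ (run a □□) (run (suc d) □■) (run r ■■) (run k ■)) ⟩
    skipsFrom leading (run a □□ ++ (run (suc d) □■ ++ trueRun r k))
  ≡⟨ reads-then (reads-replicate (reads leading □□) a)
       (reads-then (reads-enter (reads leading □■) (reads boxed □■) d) (trueRun-boxed r k)) ⟩
    a * 0 + (d * 1 + 0)
  ≡⟨ arithmetic a d ⟩
    d
  ∎
  where
  open ≡-Reasoning
  arithmetic : ∀ a d → a * 0 + (d * 1 + 0) ≡ d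
  arithmetic = solve-∀

skips-■□ : ∀ a d r k → 0 < r + k → skipsFrom leading ((run a □□ ++ (run d ■□ ++ run r ■■)) ++ run k ■) ≡ d
skips-■□ a d r k 0<r+k = trans (cong (skipsFrom leading) (++-assoc₄ (run a □□) (run d ■□) (run r ■■) (run k ■))) (skips d)
  where
  skips : ∀ d → skipsFrom leading (run a □□ ++ (run d ■□ ++ trueRun r k)) ≡ d
  skips zero = trans (reads-then (reads-replicate (reads leading □□) a) (trueRun-leading r k)) (arithmetic a)
    where
    arithmetic : ∀ a → a * 0 + 0 ≡ 0
    arithmetic = solve-∀
  skips (suc d) = trans
    (reads-then (reads-replicate (reads leading □□) a)
      (reads-then (reads-enter (reads leading ■□) (reads gap ■□) d) (trueRun-gap r k 0<r+k)))
    (arithmetic a d)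
    where
    arithmetic : ∀ a d → a * 0 + (d * 1 + 1) ≡ suc d
    arithmetic = solve-∀

skips-■□-□ : ∀ a r f t → r ≤ t → skipsFrom leading ((run a □□ ++ run r ■□) ++ (run f □ ++ run t ■)) ≡ r
skips-■□-□ a r f t r≤t = trans (cong (skipsFrom leading) (++-assoc (run a □□) (run r ■□) (run f □ ++ run t ■))) (skips r r≤t)
  where
  skips : ∀ r → r ≤ t → skipsFrom leading (run a □□ ++ (run r ■□ ++ (run f □ ++ run t ■))) ≡ r
  skips zero _ = trans
    (reads-then (reads-replicate (reads leading □□) a) (reads-then (reads-replicate (reads leading □) f) (trueRun-leading 0 t)))
    (arithmetic a f)
    where
    arithmetic : ∀ a f → a * 0 + (f * 0 + 0) ≡ 0
    arithmetic = solve-∀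
  skips (suc r) r<t = trans
    (reads-then (reads-replicate (reads leading □□) a)
      (reads-then (reads-enter (reads leading ■□) (reads gap ■□) r)
        (reads-then (reads-replicate (reads gap □) f) (trueRun-gap 0 t (<-≤-trans z<s r<t)))))
    (arithmetic a r f)
    where
    arithmetic : ∀ a r f → a * 0 + (r * 1 + (f * 0 + 1)) ≡ suc r
    arithmetic = solve-∀

skips-□■-□ : ∀ a r f t → r ≤ t → skipsFrom leading ((run a □□ ++ run r □■) ++ (run (suc f) □ ++ run t ■)) ≡ r
skips-□■-□ a r f t r≤t = trans (cong (skipsFrom leading) (++-assoc (run a □□) (run r □■) (run (suc f) □ ++ run t ■))) (skips r r≤t)
  where
  skips : ∀ r → r ≤ t → skipsFrom leading (run a □□ ++ (run r □■ ++ (run (suc f) □ ++ run t ■))) ≡ r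
  skips zero _ = trans
    (reads-then (reads-replicate (reads leading □□) a) (reads-then (reads-replicate (reads leading □) (suc f)) (trueRun-leading 0 t)))
    (arithmetic a f)
    where
    arithmetic : ∀ a f → a * 0 + (suc f * 0 + 0) ≡ 0
    arithmetic = solve-∀
  skips (suc r) r<t = trans
    (reads-then (reads-replicate (reads leading □□) a)
      (reads-then (reads-enter (reads leading □■) (reads boxed □■) r)
        (reads-then (reads-enter (reads boxed □) (reads gap □) f) (trueRun-gap 0 t (<-≤-trans z<s r<t)))))
    (arithmetic a r f)
    where
    arithmetic : ∀ a r f → a * 0 + (r * 1 + (f * 0 + 1)) ≡ suc r
    arithmetic = solve-∀

-- The rank word

rankEntry : ℕ → List Step → ℕ → List Bool
rankEntry n Π r = if isRank n r then any (inλ Π) (cellsOfRank n r) ∷ [] else []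

boxes≡concatMap-rankEntry : ∀ n Π → map proj₂ (rankWord n Π) ≡ concatMap (rankEntry n Π) (candidates n)
boxes≡concatMap-rankEntry n Π = trans (sym (map-∘ (bfilter (isRank n) (candidates n))))
  (map-bfilter (λ r → any (inλ Π) (cellsOfRank n r)) (isRank n) (candidates n))

-- With X = a n + r: column a has no cell of rank r.
Misses : ℕ → ℕ → Set
Misses NN X = ∀ K → K < NN → X ≢ 3 * K

misses-above : ∀ {NN X K} → X ≡ 3 * K → NN ≤ K → Misses NN X
misses-above {K = K} X≡3K NN≤K L L<NN X≡3L = <⇒≢ (<-≤-trans L<NN NN≤K) (*-cancelˡ-≡ L K 3 (trans (sym X≡3L) X≡3K))

misses-residue : ∀ {NN X} c K → X ≡ c + 3 * K → c % 3 ≢ 0 → Misses NN X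
misses-residue c K refl c%3≢0 L _ eq = c%3≢0 (begin
    c % 3            ≡⟨ sym ([m+kn]%n≡m%n c K 3) ⟩
    (c + K * 3) % 3  ≡⟨ cong (λ x → (c + x) % 3) (*-comm K 3) ⟩
    (c + 3 * K) % 3  ≡⟨ cong (_% 3) eq ⟩
    (3 * L) % 3      ≡⟨ cong (_% 3) (*-comm 3 L) ⟩
    (L * 3) % 3      ≡⟨ m*n%n≡0 L 3 ⟩
    0                ∎)
  where open ≡-Reasoning

columnHits : ℕ → ℕ → (ℕ → Bool) → Bool
columnHits NN X g = any (λ b → (X ≡ᵇ 3 * (b ∸ 1)) ∧ g b) (rows NN)

columnHits-hit : ∀ {NN X K} g → X ≡ 3 * K → K < NN → columnHits NN X g ≡ g (suc K)
columnHits-hit {NN} {X} {K} g X≡3K K<NN = begin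
    columnHits NN X g
  ≡⟨ cong (any _) (rows≡segment NN) ⟩
    any f (segment 0 NN)
  ≡⟨ any-segment-unique 0 NN (suc K) z<s K<NN others ⟩
    (X ≡ᵇ 3 * K) ∧ g (suc K)
  ≡⟨ cong (_∧ g (suc K)) (≡ᵇ-true X≡3K) ⟩
    g (suc K)
  ∎
  where
  open ≡-Reasoning
  f : ℕ → Bool
  f b = (X ≡ᵇ 3 * (b ∸ 1)) ∧ g b
  others : ∀ b → 0 < b → b ≤ NN → b ≢ suc K → f b ≡ false
  others (suc L) _ _ L≢K =
    ∧-false (g (suc L)) (≡ᵇ-false (λ X≡3L → L≢K (cong suc (*-cancelˡ-≡ L K 3 (trans (sym X≡3L) X≡3K)))))

columnHits-miss : ∀ {NN X} g → Misses NN X → columnHits NN X g ≡ false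
columnHits-miss {NN} {X} g misses = trans (cong (any _) (rows≡segment NN))
  (any-segment-none 0 NN (λ { (suc L) _ L<NN → ∧-false (g (suc L)) (≡ᵇ-false (misses L L<NN)) }))

rankedCells : ℕ → ℕ → (ℕ × ℕ → Bool) → Bool
rankedCells n r g = any (λ c → hasRank n r c ∧ g c) (cells n)

rankedCells-columns : ∀ n r g → rankedCells n r g ≡
    columnHits n (1 * n + r) (λ b → g (1 , b))
  ∨ (columnHits n (2 * n + r) (λ b → g (2 , b)) ∨ (columnHits n (3 * n + r) (λ b → g (3 , b)) ∨ false))
rankedCells-columns n r g = any-cells (λ c → hasRank n r c ∧ g c) n

rankEntry-none : ∀ n r Π → (∀ g → rankedCells n r g ≡ false) → rankEntry n Π r ≡ []
rankEntry-none n r Π none rewrite any-cong (cells n) (λ c → sym (∧-identityʳ (hasRank n r c))) | none (λ _ → true) = refl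

rankEntry-hit : ∀ n r Π c → (∀ g → rankedCells n r g ≡ g c) → rankEntry n Π r ≡ inλ Π c ∷ []
rankEntry-hit n r Π c hit
  rewrite any-cong (cells n) (λ c → sym (∧-identityʳ (hasRank n r c))) | hit (λ _ → true)
        | any-bfilter (inλ Π) (hasRank n r) (cells n) | hit (inλ Π) = refl

rankedCells-none : ∀ {n r} g → Misses n (1 * n + r) → Misses n (2 * n + r) → Misses n (3 * n + r) → rankedCells n r g ≡ false
rankedCells-none {n} {r} g miss₁ miss₂ miss₃ rewrite rankedCells-columns n r g
  | columnHits-miss (λ b → g (1 , b)) miss₁ | columnHits-miss (λ b → g (2 , b)) miss₂ | columnHits-miss (λ b → g (3 , b)) miss₃ = refl

rankedCells-column₁ : ∀ {n r K} g → 1 * n + r ≡ 3 * K → K < n → Misses n (2 * n + r) → Misses n (3 * n + r) →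
  rankedCells n r g ≡ g (1 , suc K)
rankedCells-column₁ {n} {r} g hit K<n miss₂ miss₃ rewrite rankedCells-columns n r g
  | columnHits-hit (λ b → g (1 , b)) hit K<n | columnHits-miss (λ b → g (2 , b)) miss₂ | columnHits-miss (λ b → g (3 , b)) miss₃ =
  ∨-identityʳ _

rankedCells-column₂ : ∀ {n r K} g → Misses n (1 * n + r) → 2 * n + r ≡ 3 * K → K < n → Misses n (3 * n + r) →
  rankedCells n r g ≡ g (2 , suc K)
rankedCells-column₂ {n} {r} g miss₁ hit K<n miss₃ rewrite rankedCells-columns n r g
  | columnHits-miss (λ b → g (1 , b)) miss₁ | columnHits-hit (λ b → g (2 , b)) hit K<n | columnHits-miss (λ b → g (3 , b)) miss₃ =
  ∨-identityʳ _

stepAt : ℕ → ℕ → Bool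
stepAt t j = t ≤ᵇ j

stepAt-below : ∀ {t j k} → j + k ≤ t → ConstantOn (stepAt t) j k false
stepAt-below j+k≤t i _ i< = ≤ᵇ-false (<-≤-trans i< j+k≤t)

stepAt-above : ∀ {t j k} → t ≤ j → ConstantOn (stepAt t) j k true
stepAt-above t≤j i j≤i _ = ≤ᵇ-true (≤-trans t≤j j≤i)

pairs : (ℕ → Bool) → (ℕ → Bool) → ℕ → ℕ → List Bool
pairs x y = blocks (λ i → x i ∷ y i ∷ [])

singles : (ℕ → Bool) → ℕ → ℕ → List Bool
singles x = blocks (λ i → x i ∷ [])

pairs-const : ∀ x y j k {u v} → ConstantOn x j k u → ConstantOn y j k v → pairs x y j k ≡ run k (u ∷ v ∷ [])
pairs-const x y j k {u} {v} x≡u y≡v =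
  blocks-const (u ∷ v ∷ []) j k (λ i j≤i i< → cong₂ (λ a b → a ∷ b ∷ []) (x≡u i j≤i i<) (y≡v i j≤i i<))

singles-const : ∀ x j k {u} → ConstantOn x j k u → singles x j k ≡ run k (u ∷ [])
singles-const x j k {u} x≡u = blocks-const (u ∷ []) j k (λ i j≤i i< → cong (_∷ []) (x≡u i j≤i i<))

rank-column₁ : ∀ ρ m i j → 1 * (ρ + 3 * m) + (i + 3 * j) ≡ (ρ + i) + 3 * (m + j)
rank-column₁ = solve-∀

rank-column₂ : ∀ ρ m i j → 2 * (ρ + 3 * m) + (i + 3 * j) ≡ (2 * ρ + i) + 3 * (2 * m + j)
rank-column₂ = solve-∀

rank-column₃ : ∀ ρ m i j → 3 * (ρ + 3 * m) + (i + 3 * j) ≡ (3 * ρ + i) + 3 * (3 * m + j)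
rank-column₃ = solve-∀

threefold : ∀ t K → 3 * t + 3 * K ≡ 3 * (t + K)
threefold t K = sym (*-distribˡ-+ 3 t K)

height-step : ∀ {H} c t j → H ≡ c + t → (H <ᵇ suc (c + j)) ≡ stepAt t j
height-step zero    zero    j refl = refl
height-step zero    (suc t) j refl = refl
height-step (suc c) t       j refl = height-step c t j refl

-- Boxed/unboxed pattern of the rank word for n = 3m + 1 (resp. 3m + 2) when the first two columns have
-- heights m + 1 + q and 2m + 1 + p (resp. 2m + 2 + p).
word₁ : ℕ → ℕ → ℕ → List Bool
word₁ m p q = pairs (stepAt p) (stepAt q) 0 m ++ singles (stepAt q) m m

word₂ : ℕ → ℕ → ℕ → List Bool
word₂ m p q = pairs (stepAt q) (stepAt p) 0 m ++ singles (stepAt q) m (suc m)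

-- For n = 3m + 1 the candidate 3j + 1 lies in column 2, 3j + 2 in column 1, and 3j + 3 in no column.
module RankWord₁ (m p q : ℕ) (Π : List Step) (h₁≡ : h Π 1 ≡ suc m + q) (h₂≡ : h Π 2 ≡ suc (2 * m) + p) where

  private
    n : ℕ
    n = suc (3 * m)

    entry : ℕ → List Bool
    entry = rankEntry n Π

    block : ℕ → List Bool
    block j = concatMap entry (segment (3 * j) 3)

    entry-1+3j : ∀ j → j < m → entry (1 + 3 * j) ≡ stepAt p j ∷ []
    entry-1+3j j j<m = trans
      (rankEntry-hit n (1 + 3 * j) Π (2 , suc (suc (2 * m + j))) (λ g → rankedCells-column₂ g
        (misses-residue 2 (m + j) (rank-column₁ 1 m 1 j) (λ ()))
        (trans (rank-column₂ 1 m 1 j) (threefold 1 (2 * m + j))) (s≤s K<3m)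
        (misses-residue 4 (3 * m + j) (rank-column₃ 1 m 1 j) (λ ()))))
      (cong (_∷ []) (height-step (suc (2 * m)) p j h₂≡))
      where
      K<3m : 2 * m + j < 3 * m
      K<3m = <-≤-trans (+-monoʳ-< (2 * m) j<m) (≤-reflexive (arithmetic m))
        where
        arithmetic : ∀ m → 2 * m + m ≡ 3 * m
        arithmetic = solve-∀

    entry-1+3j-none : ∀ j → m ≤ j → entry (1 + 3 * j) ≡ []
    entry-1+3j-none j m≤j = rankEntry-none n (1 + 3 * j) Π (λ g → rankedCells-none g
      (misses-residue 2 (m + j) (rank-column₁ 1 m 1 j) (λ ()))
      (misses-above (trans (rank-column₂ 1 m 1 j) (threefold 1 (2 * m + j))) (s≤s n≤K))
      (misses-residue 4 (3 * m + j) (rank-column₃ 1 m 1 j) (λ ())))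
      where
      n≤K : 3 * m ≤ 2 * m + j
      n≤K = ≤-trans (≤-reflexive (arithmetic m)) (+-monoʳ-≤ (2 * m) m≤j)
        where
        arithmetic : ∀ m → 3 * m ≡ 2 * m + m
        arithmetic = solve-∀

    entry-2+3j : ∀ j → j < m + m → entry (2 + 3 * j) ≡ stepAt q j ∷ []
    entry-2+3j j j<2m = trans
      (rankEntry-hit n (2 + 3 * j) Π (1 , suc (suc (m + j))) (λ g → rankedCells-column₁ g
        (trans (rank-column₁ 1 m 2 j) (threefold 1 (m + j))) (s≤s K<3m)
        (misses-residue 4 (2 * m + j) (rank-column₂ 1 m 2 j) (λ ()))
        (misses-residue 5 (3 * m + j) (rank-column₃ 1 m 2 j) (λ ()))))
      (cong (_∷ []) (height-step (suc m) q j h₁≡))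
      where
      K<3m : m + j < 3 * m
      K<3m = <-≤-trans (+-monoʳ-< m j<2m) (≤-reflexive (arithmetic m))
        where
        arithmetic : ∀ m → m + (m + m) ≡ 3 * m
        arithmetic = solve-∀

    entry-2+3j-none : ∀ j → m + m ≤ j → entry (2 + 3 * j) ≡ []
    entry-2+3j-none j 2m≤j = rankEntry-none n (2 + 3 * j) Π (λ g → rankedCells-none g
      (misses-above (trans (rank-column₁ 1 m 2 j) (threefold 1 (m + j))) (s≤s n≤K))
      (misses-residue 4 (2 * m + j) (rank-column₂ 1 m 2 j) (λ ()))
      (misses-residue 5 (3 * m + j) (rank-column₃ 1 m 2 j) (λ ())))
      where
      n≤K : 3 * m ≤ m + j
      n≤K = ≤-trans (≤-reflexive (arithmetic m)) (+-monoʳ-≤ m 2m≤j)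
        where
        arithmetic : ∀ m → 3 * m ≡ m + (m + m)
        arithmetic = solve-∀

    entry-3+3j : ∀ j → entry (3 + 3 * j) ≡ []
    entry-3+3j j = rankEntry-none n (3 + 3 * j) Π (λ g → rankedCells-none g
      (misses-residue 4 (m + j) (rank-column₁ 1 m 3 j) (λ ()))
      (misses-residue 5 (2 * m + j) (rank-column₂ 1 m 3 j) (λ ()))
      (misses-above (trans (rank-column₃ 1 m 3 j) (threefold 2 (3 * m + j))) (s≤s (≤-trans (m≤m+n (3 * m) j) (n≤1+n _)))))

    block-pair : ∀ j → j < m → block j ≡ stepAt p j ∷ stepAt q j ∷ []
    block-pair j j<m rewrite entry-1+3j j j<m | entry-2+3j j (≤-trans j<m (m≤m+n m m)) | entry-3+3j j = refl

    block-single : ∀ j → m ≤ j → j < m + m → block j ≡ stepAt q j ∷ []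
    block-single j m≤j j<2m rewrite entry-1+3j-none j m≤j | entry-2+3j j j<2m | entry-3+3j j = refl

    block-empty : ∀ j → m + m ≤ j → block j ≡ []
    block-empty j 2m≤j rewrite entry-1+3j-none j (≤-trans (m≤m+n m m) 2m≤j) | entry-2+3j-none j 2m≤j | entry-3+3j j = refl

  boxes≡word : map proj₂ (rankWord n Π) ≡ word₁ m p q
  boxes≡word = begin
      map proj₂ (rankWord n Π)
    ≡⟨ boxes≡concatMap-rankEntry n Π ⟩
      concatMap entry (candidates n)
    ≡⟨ cong (concatMap entry) (rows≡segment (3 * n)) ⟩
      concatMap entry (segment 0 (3 * n))
    ≡⟨ concatMap-segment-blocks entry 0 n ⟩
      blocks block 0 n
    ≡⟨ cong (blocks block 0) (arithmetic m) ⟩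
      blocks block 0 (m + (m + suc m))
    ≡⟨ blocks-++₃ block 0 m m (suc m) ⟩
      blocks block 0 m ++ (blocks block m m ++ blocks block (m + m) (suc m))
    ≡⟨ cong₂ _++_ (blocks-cong 0 m (λ j _ j<m → block-pair j j<m))
                  (cong₂ _++_ (blocks-cong m m (λ j m≤j j<2m → block-single j m≤j j<2m))
                              (blocks-nil (m + m) (suc m) (λ j 2m≤j _ → block-empty j 2m≤j))) ⟩
      pairs (stepAt p) (stepAt q) 0 m ++ (singles (stepAt q) m m ++ [])
    ≡⟨ cong (pairs (stepAt p) (stepAt q) 0 m ++_) (++-identityʳ _) ⟩
      word₁ m p q
    ∎
    where
    open ≡-Reasoning
    arithmetic : ∀ m → suc (3 * m) ≡ m + (m + suc m)
    arithmetic = solve-∀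

-- For n = 3m + 2 the candidate 3j + 1 lies in column 1, 3j + 2 in column 2, and 3j + 3 in no column.
module RankWord₂ (m p q : ℕ) (Π : List Step) (h₁≡ : h Π 1 ≡ suc m + q) (h₂≡ : h Π 2 ≡ suc (suc (2 * m)) + p) where

  private
    n : ℕ
    n = suc (suc (3 * m))

    entry : ℕ → List Bool
    entry = rankEntry n Π

    block : ℕ → List Bool
    block j = concatMap entry (segment (3 * j) 3)

    entry-1+3j : ∀ j → j < suc (m + m) → entry (1 + 3 * j) ≡ stepAt q j ∷ []
    entry-1+3j j j≤2m = trans
      (rankEntry-hit n (1 + 3 * j) Π (1 , suc (suc (m + j))) (λ g → rankedCells-column₁ g
        (trans (rank-column₁ 2 m 1 j) (threefold 1 (m + j))) (s≤s (s≤s K≤3m))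
        (misses-residue 5 (2 * m + j) (rank-column₂ 2 m 1 j) (λ ()))
        (misses-residue 7 (3 * m + j) (rank-column₃ 2 m 1 j) (λ ()))))
      (cong (_∷ []) (height-step (suc m) q j h₁≡))
      where
      K≤3m : m + j ≤ 3 * m
      K≤3m = ≤-trans (+-monoʳ-≤ m (≤-pred j≤2m)) (≤-reflexive (arithmetic m))
        where
        arithmetic : ∀ m → m + (m + m) ≡ 3 * m
        arithmetic = solve-∀

    entry-1+3j-none : ∀ j → suc (m + m) ≤ j → entry (1 + 3 * j) ≡ []
    entry-1+3j-none j 2m<j = rankEntry-none n (1 + 3 * j) Π (λ g → rankedCells-none g
      (misses-above (trans (rank-column₁ 2 m 1 j) (threefold 1 (m + j))) (s≤s n≤K))
      (misses-residue 5 (2 * m + j) (rank-column₂ 2 m 1 j) (λ ()))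
      (misses-residue 7 (3 * m + j) (rank-column₃ 2 m 1 j) (λ ())))
      where
      n≤K : suc (3 * m) ≤ m + j
      n≤K = ≤-trans (≤-reflexive (arithmetic m)) (+-monoʳ-≤ m 2m<j)
        where
        arithmetic : ∀ m → suc (3 * m) ≡ m + suc (m + m)
        arithmetic = solve-∀

    entry-2+3j : ∀ j → j < m → entry (2 + 3 * j) ≡ stepAt p j ∷ []
    entry-2+3j j j<m = trans
      (rankEntry-hit n (2 + 3 * j) Π (2 , suc (suc (suc (2 * m + j)))) (λ g → rankedCells-column₂ g
        (misses-residue 4 (m + j) (rank-column₁ 2 m 2 j) (λ ()))
        (trans (rank-column₂ 2 m 2 j) (threefold 2 (2 * m + j))) (s≤s (s≤s K<3m))
        (misses-residue 8 (3 * m + j) (rank-column₃ 2 m 2 j) (λ ()))))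
      (cong (_∷ []) (height-step (suc (suc (2 * m))) p j h₂≡))
      where
      K<3m : 2 * m + j < 3 * m
      K<3m = <-≤-trans (+-monoʳ-< (2 * m) j<m) (≤-reflexive (arithmetic m))
        where
        arithmetic : ∀ m → 2 * m + m ≡ 3 * m
        arithmetic = solve-∀

    entry-2+3j-none : ∀ j → m ≤ j → entry (2 + 3 * j) ≡ []
    entry-2+3j-none j m≤j = rankEntry-none n (2 + 3 * j) Π (λ g → rankedCells-none g
      (misses-residue 4 (m + j) (rank-column₁ 2 m 2 j) (λ ()))
      (misses-above (trans (rank-column₂ 2 m 2 j) (threefold 2 (2 * m + j))) (s≤s (s≤s n≤K)))
      (misses-residue 8 (3 * m + j) (rank-column₃ 2 m 2 j) (λ ())))
      where
      n≤K : 3 * m ≤ 2 * m + j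
      n≤K = ≤-trans (≤-reflexive (arithmetic m)) (+-monoʳ-≤ (2 * m) m≤j)
        where
        arithmetic : ∀ m → 3 * m ≡ 2 * m + m
        arithmetic = solve-∀

    entry-3+3j : ∀ j → entry (3 + 3 * j) ≡ []
    entry-3+3j j = rankEntry-none n (3 + 3 * j) Π (λ g → rankedCells-none g
      (misses-residue 5 (m + j) (rank-column₁ 2 m 3 j) (λ ()))
      (misses-residue 7 (2 * m + j) (rank-column₂ 2 m 3 j) (λ ()))
      (misses-above (trans (rank-column₃ 2 m 3 j) (threefold 3 (3 * m + j))) (s≤s (s≤s (≤-trans (m≤m+n (3 * m) j) (n≤1+n _))))))

    block-pair : ∀ j → j < m → block j ≡ stepAt q j ∷ stepAt p j ∷ []
    block-pair j j<m rewrite entry-1+3j j (≤-trans j<m (≤-trans (m≤m+n m m) (n≤1+n _))) | entry-2+3j j j<m | entry-3+3j j = refl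

    block-single : ∀ j → m ≤ j → j < suc (m + m) → block j ≡ stepAt q j ∷ []
    block-single j m≤j j≤2m rewrite entry-1+3j j j≤2m | entry-2+3j-none j m≤j | entry-3+3j j = refl

    block-empty : ∀ j → suc (m + m) ≤ j → block j ≡ []
    block-empty j 2m<j rewrite entry-1+3j-none j 2m<j | entry-2+3j-none j (≤-trans (m≤m+n m m) (≤-trans (n≤1+n _) 2m<j))
      | entry-3+3j j = refl

  boxes≡word : map proj₂ (rankWord n Π) ≡ word₂ m p q
  boxes≡word = begin
      map proj₂ (rankWord n Π)
    ≡⟨ boxes≡concatMap-rankEntry n Π ⟩
      concatMap entry (candidates n)
    ≡⟨ cong (concatMap entry) (rows≡segment (3 * n)) ⟩
      concatMap entry (segment 0 (3 * n))
    ≡⟨ concatMap-segment-blocks entry 0 n ⟩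
      blocks block 0 n
    ≡⟨ cong (blocks block 0) (arithmetic m) ⟩
      blocks block 0 (m + (suc m + suc m))
    ≡⟨ blocks-++₃ block 0 m (suc m) (suc m) ⟩
      blocks block 0 m ++ (blocks block m (suc m) ++ blocks block (m + suc m) (suc m))
    ≡⟨ cong₂ _++_ (blocks-cong 0 m (λ j _ j<m → block-pair j j<m))
                  (cong₂ _++_ (blocks-cong m (suc m) (λ j m≤j j< → block-single j m≤j (≤-trans j< (≤-reflexive (+-suc m m)))))
                              (blocks-nil (m + suc m) (suc m) (λ j 2m<j _ → block-empty j (≤-trans (≤-reflexive (sym (+-suc m m))) 2m<j)))) ⟩
      pairs (stepAt q) (stepAt p) 0 m ++ (singles (stepAt q) m (suc m) ++ [])
    ≡⟨ cong (pairs (stepAt q) (stepAt p) 0 m ++_) (++-identityʳ _) ⟩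
      word₂ m p q
    ∎
    where
    open ≡-Reasoning
    arithmetic : ∀ m → suc (suc (3 * m)) ≡ m + (suc m + suc m)
    arithmetic = solve-∀

-- The three relative positions of the thresholds p ≤ m and q ≤ m + p (for n = 3m + 1).
data Shape₁ : ℕ → ℕ → ℕ → Set where
  early  : ∀ q d r → Shape₁ (suc q + d + r) (suc q + d) q
  middle : ∀ p d r → Shape₁ (suc (p + d) + r) p (p + d)
  late   : ∀ d s r → Shape₁ (d + s + r) (d + s) (d + s + r + d)

shape₁ : ∀ {m p q} → p ≤ m → q ≤ m + p → Shape₁ m p q
shape₁ {m} {p} {q} p≤m q≤m+p with <-≤-connex q p
... | inj₁ q<p = early′ q<p p≤m
  where
  early′ : ∀ {m p q} → q < p → p ≤ m → Shape₁ m p q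
  early′ q<p p≤m with m≤n⇒∃[o]m+o≡n q<p | m≤n⇒∃[o]m+o≡n p≤m
  ... | d , refl | r , refl = early _ d r
... | inj₂ p≤q with <-≤-connex q m
...   | inj₁ q<m = middle′ p≤q q<m
  where
  middle′ : ∀ {m p q} → p ≤ q → q < m → Shape₁ m p q
  middle′ p≤q q<m with m≤n⇒∃[o]m+o≡n p≤q | m≤n⇒∃[o]m+o≡n q<m
  ... | d , refl | r , refl = middle _ d r
...   | inj₂ m≤q = late′ p≤m m≤q q≤m+p
  where
  late′ : ∀ {m p q} → p ≤ m → m ≤ q → q ≤ m + p → Shape₁ m p q
  late′ {p = p} p≤m m≤q q≤m+p with m≤n⇒∃[o]m+o≡n p≤m | m≤n⇒∃[o]m+o≡n m≤q
  ... | r , refl | d , refl with m≤n⇒∃[o]m+o≡n (+-cancelˡ-≤ (p + r) d p q≤m+p)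
  ...   | s , refl = late d s r

-- The three relative positions of the thresholds p ≤ m and q ≤ m + p + 1 (for n = 3m + 2).
data Shape₂ : ℕ → ℕ → ℕ → Set where
  early  : ∀ q d r → Shape₂ (q + d + r) (q + d) q
  middle : ∀ p d r → Shape₂ (suc p + d + r) p (suc p + d)
  late   : ∀ d s r → Shape₂ (d + s + r) (d + s) (suc (d + s + r) + d)

shape₂ : ∀ {m p q} → p ≤ m → q ≤ suc (m + p) → Shape₂ m p q
shape₂ {m} {p} {q} p≤m q≤m+p+1 with ≤-<-connex q p
... | inj₁ q≤p = early′ q≤p p≤m
  where
  early′ : ∀ {m p q} → q ≤ p → p ≤ m → Shape₂ m p q
  early′ q≤p p≤m with m≤n⇒∃[o]m+o≡n q≤p | m≤n⇒∃[o]m+o≡n p≤m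
  ... | d , refl | r , refl = early _ d r
... | inj₂ p<q with ≤-<-connex q m
...   | inj₁ q≤m = middle′ p<q q≤m
  where
  middle′ : ∀ {m p q} → p < q → q ≤ m → Shape₂ m p q
  middle′ p<q q≤m with m≤n⇒∃[o]m+o≡n p<q | m≤n⇒∃[o]m+o≡n q≤m
  ... | d , refl | r , refl = middle _ d r
...   | inj₂ m<q = late′ p≤m m<q q≤m+p+1
  where
  late′ : ∀ {m p q} → p ≤ m → m < q → q ≤ suc (m + p) → Shape₂ m p q
  late′ {p = p} p≤m m<q q≤ with m≤n⇒∃[o]m+o≡n p≤m | m≤n⇒∃[o]m+o≡n m<q
  ... | r , refl | d , refl with m≤n⇒∃[o]m+o≡n (+-cancelˡ-≤ (suc (p + r)) d p q≤)
  ...   | s , refl = late d s r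

skipWord-early₁ : ∀ q d r → skipWord (word₁ (suc q + d + r) (suc q + d) q) ≡ d
skipWord-early₁ q d r = begin
    skipWord (word₁ m p q)
  ≡⟨ skipWord≡skipsFrom (word₁ m p q) ⟩
    skipsFrom leading (pairs x y 0 m ++ singles y m m)
  ≡⟨ cong (skipsFrom leading) (cong₂ _++_ pairs≡ (singles-const y m m (stepAt-above q≤m))) ⟩
    skipsFrom leading ((run q □□ ++ (run (suc d) □■ ++ run r ■■)) ++ run m ■)
  ≡⟨ skips-□■ q d r m ⟩
    d
  ∎
  where
  open ≡-Reasoning
  m p : ℕ
  m = suc q + d + r
  p = suc q + d
  x y : ℕ → Bool
  x = stepAt p
  y = stepAt q
  q≤m : q ≤ m
  q≤m = ≤-trans (n≤1+n q) (≤-trans (m≤m+n (suc q) d) (m≤m+n p r))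
  arithmetic : ∀ q d r → suc q + d + r ≡ q + (suc d + r)
  arithmetic = solve-∀
  pairs≡ : pairs x y 0 m ≡ run q □□ ++ (run (suc d) □■ ++ run r ■■)
  pairs≡ = trans (cong (pairs x y 0) (arithmetic q d r)) (trans (blocks-++₃ _ 0 q (suc d) r) (cong₂ _++_
    (pairs-const x y 0 q (stepAt-below (≤-trans (n≤1+n q) (m≤m+n (suc q) d))) (stepAt-below ≤-refl))
    (cong₂ _++_ (pairs-const x y q (suc d) (stepAt-below (≤-reflexive (+-suc q d))) (stepAt-above ≤-refl))
                (pairs-const x y (q + suc d) r (stepAt-above (≤-reflexive (sym (+-suc q d)))) (stepAt-above (m≤m+n q (suc d)))))))

skipWord-middle₁ : ∀ p d r → skipWord (word₁ (suc (p + d) + r) p (p + d)) ≡ d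
skipWord-middle₁ p d r = begin
    skipWord (word₁ m p q)
  ≡⟨ skipWord≡skipsFrom (word₁ m p q) ⟩
    skipsFrom leading (pairs x y 0 m ++ singles y m m)
  ≡⟨ cong (skipsFrom leading) (cong₂ _++_ pairs≡ (singles-const y m m (stepAt-above (≤-trans (n≤1+n q) (m≤m+n (suc q) r))))) ⟩
    skipsFrom leading ((run p □□ ++ (run d ■□ ++ run (suc r) ■■)) ++ run m ■)
  ≡⟨ skips-■□ p d (suc r) m z<s ⟩
    d
  ∎
  where
  open ≡-Reasoning
  m q : ℕ
  m = suc (p + d) + r
  q = p + d
  x y : ℕ → Bool
  x = stepAt p
  y = stepAt q
  arithmetic : ∀ p d r → suc (p + d) + r ≡ p + (d + suc r)
  arithmetic = solve-∀
  pairs≡ : pairs x y 0 m ≡ run p □□ ++ (run d ■□ ++ run (suc r) ■■)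
  pairs≡ = trans (cong (pairs x y 0) (arithmetic p d r)) (trans (blocks-++₃ _ 0 p d (suc r)) (cong₂ _++_
    (pairs-const x y 0 p (stepAt-below ≤-refl) (stepAt-below (m≤m+n p d)))
    (cong₂ _++_ (pairs-const x y p d (stepAt-above ≤-refl) (stepAt-below ≤-refl))
                (pairs-const x y (p + d) (suc r) (stepAt-above (m≤m+n p d)) (stepAt-above ≤-refl)))))

skipWord-late₁ : ∀ d s r → skipWord (word₁ (d + s + r) (d + s) (d + s + r + d)) ≡ r
skipWord-late₁ d s r = begin
    skipWord (word₁ m p q)
  ≡⟨ skipWord≡skipsFrom (word₁ m p q) ⟩
    skipsFrom leading (pairs x y 0 m ++ singles y m m)
  ≡⟨ cong (skipsFrom leading) (cong₂ _++_ pairs≡ singles≡) ⟩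
    skipsFrom leading ((run p □□ ++ run r ■□) ++ (run d □ ++ run (s + r) ■))
  ≡⟨ skips-■□-□ p r d (s + r) (m≤n+m r s) ⟩
    r
  ∎
  where
  open ≡-Reasoning
  m p q : ℕ
  m = d + s + r
  p = d + s
  q = d + s + r + d
  x y : ℕ → Bool
  x = stepAt p
  y = stepAt q
  pairs≡ : pairs x y 0 m ≡ run p □□ ++ run r ■□
  pairs≡ = trans (blocks-++ _ 0 p r) (cong₂ _++_
    (pairs-const x y 0 p (stepAt-below ≤-refl) (stepAt-below (≤-trans (m≤m+n p r) (m≤m+n m d))))
    (pairs-const x y p r (stepAt-above ≤-refl) (stepAt-below (m≤m+n m d))))
  singles≡ : singles y m m ≡ run d □ ++ run (s + r) ■
  singles≡ = trans (cong (singles y m) (+-assoc d s r)) (trans (blocks-++ _ m d (s + r)) (cong₂ _++_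
    (singles-const y m d (stepAt-below ≤-refl)) (singles-const y q (s + r) (stepAt-above ≤-refl))))

skipWord-early₂ : ∀ q d r → skipWord (word₂ (q + d + r) (q + d) q) ≡ d
skipWord-early₂ q d r = begin
    skipWord (word₂ m p q)
  ≡⟨ skipWord≡skipsFrom (word₂ m p q) ⟩
    skipsFrom leading (pairs x y 0 m ++ singles x m (suc m))
  ≡⟨ cong (skipsFrom leading) (cong₂ _++_ pairs≡ (singles-const x m (suc m) (stepAt-above (≤-trans (m≤m+n q d) (m≤m+n p r))))) ⟩
    skipsFrom leading ((run q □□ ++ (run d ■□ ++ run r ■■)) ++ run (suc m) ■)
  ≡⟨ skips-■□ q d r (suc m) (<-≤-trans z<s (m≤n+m (suc m) r)) ⟩
    d
  ∎
  where
  open ≡-Reasoning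
  m p : ℕ
  m = q + d + r
  p = q + d
  x y : ℕ → Bool
  x = stepAt q
  y = stepAt p
  pairs≡ : pairs x y 0 m ≡ run q □□ ++ (run d ■□ ++ run r ■■)
  pairs≡ = trans (cong (pairs x y 0) (+-assoc q d r)) (trans (blocks-++₃ _ 0 q d r) (cong₂ _++_
    (pairs-const x y 0 q (stepAt-below ≤-refl) (stepAt-below (m≤m+n q d)))
    (cong₂ _++_ (pairs-const x y q d (stepAt-above ≤-refl) (stepAt-below ≤-refl))
                (pairs-const x y p r (stepAt-above (m≤m+n q d)) (stepAt-above ≤-refl)))))

skipWord-middle₂ : ∀ p d r → skipWord (word₂ (suc p + d + r) p (suc p + d)) ≡ d
skipWord-middle₂ p d r = begin
    skipWord (word₂ m p q)
  ≡⟨ skipWord≡skipsFrom (word₂ m p q) ⟩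
    skipsFrom leading (pairs x y 0 m ++ singles x m (suc m))
  ≡⟨ cong (skipsFrom leading) (cong₂ _++_ pairs≡ (singles-const x m (suc m) (stepAt-above (m≤m+n q r)))) ⟩
    skipsFrom leading ((run p □□ ++ (run (suc d) □■ ++ run r ■■)) ++ run (suc m) ■)
  ≡⟨ skips-□■ p d r (suc m) ⟩
    d
  ∎
  where
  open ≡-Reasoning
  m q : ℕ
  m = suc p + d + r
  q = suc p + d
  x y : ℕ → Bool
  x = stepAt q
  y = stepAt p
  arithmetic : ∀ p d r → suc p + d + r ≡ p + (suc d + r)
  arithmetic = solve-∀
  pairs≡ : pairs x y 0 m ≡ run p □□ ++ (run (suc d) □■ ++ run r ■■)
  pairs≡ = trans (cong (pairs x y 0) (arithmetic p d r)) (trans (blocks-++₃ _ 0 p (suc d) r) (cong₂ _++_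
    (pairs-const x y 0 p (stepAt-below (≤-trans (n≤1+n p) (m≤m+n (suc p) d))) (stepAt-below ≤-refl))
    (cong₂ _++_ (pairs-const x y p (suc d) (stepAt-below (≤-reflexive (+-suc p d))) (stepAt-above ≤-refl))
                (pairs-const x y (p + suc d) r (stepAt-above (≤-reflexive (sym (+-suc p d)))) (stepAt-above (m≤m+n p (suc d)))))))

skipWord-late₂ : ∀ d s r → skipWord (word₂ (d + s + r) (d + s) (suc (d + s + r) + d)) ≡ r
skipWord-late₂ d s r = begin
    skipWord (word₂ m p q)
  ≡⟨ skipWord≡skipsFrom (word₂ m p q) ⟩
    skipsFrom leading (pairs x y 0 m ++ singles x m (suc m))
  ≡⟨ cong (skipsFrom leading) (cong₂ _++_ pairs≡ singles≡) ⟩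
    skipsFrom leading ((run p □□ ++ run r □■) ++ (run (suc d) □ ++ run (s + r) ■))
  ≡⟨ skips-□■-□ p r d (s + r) (m≤n+m r s) ⟩
    r
  ∎
  where
  open ≡-Reasoning
  m p q : ℕ
  m = d + s + r
  p = d + s
  q = suc (d + s + r) + d
  x y : ℕ → Bool
  x = stepAt q
  y = stepAt p
  p+r≤q : p + r ≤ q
  p+r≤q = ≤-trans (n≤1+n m) (m≤m+n (suc m) d)
  pairs≡ : pairs x y 0 m ≡ run p □□ ++ run r □■
  pairs≡ = trans (blocks-++ _ 0 p r) (cong₂ _++_
    (pairs-const x y 0 p (stepAt-below (≤-trans (m≤m+n p r) p+r≤q)) (stepAt-below ≤-refl))
    (pairs-const x y p r (stepAt-below p+r≤q) (stepAt-above ≤-refl)))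
  singles≡ : singles x m (suc m) ≡ run (suc d) □ ++ run (s + r) ■
  singles≡ = trans (cong (λ k → singles x m (suc k)) (+-assoc d s r))
    (trans (blocks-++ (λ i → x i ∷ []) m (suc d) (s + r)) (cong₂ _++_
    (singles-const x m (suc d) (stepAt-below (≤-reflexive (+-suc m d))))
    (singles-const x (m + suc d) (s + r) (stepAt-above (≤-reflexive (sym (+-suc m d)))))))

-- The statistics for n = 3m + 1 and n = 3m + 2

module Residue₁ (m : ℕ) where

  n : ℕ
  n = suc (3 * m)

  upper : n < 3 * suc m
  upper = m+o≡n⇒m≤n 1 (arithmetic m)
    where
    arithmetic : ∀ m → suc (suc (3 * m)) + 1 ≡ 3 * suc m
    arithmetic = solve-∀

  open Legs {n} {m} ≤-refl upper public

  module Heights {Π} (dyck : IsDyck n Π) where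
    open Dyck dyck

    q p : ℕ
    q = h Π 1 ∸ suc m
    p = h Π 2 ∸ suc (2 * m)

    m<h₁ : m < h Π 1
    m<h₁ = *-cancelˡ-< 3 m (h Π 1) (≤-trans (≤-reflexive (sym (*-identityʳ n))) (column-above 1 z<s (s≤s z≤n)))

    2m<h₂ : 2 * m < h Π 2
    2m<h₂ = *-cancelˡ-< 3 (2 * m) (h Π 2) (≤-trans (m+o≡n⇒m≤n 1 (arithmetic m)) (column-above 2 z<s (s≤s (s≤s z≤n))))
      where
      arithmetic : ∀ m → suc (3 * (2 * m)) + 1 ≡ suc (3 * m) * 2
      arithmetic = solve-∀

    h₁≡ : h Π 1 ≡ suc m + q
    h₁≡ = sym (m+[n∸m]≡n m<h₁)

    h₂≡ : h Π 2 ≡ suc (2 * m) + p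
    h₂≡ = sym (m+[n∸m]≡n 2m<h₂)

    p≤m : p ≤ m
    p≤m = +-cancelˡ-≤ (suc (2 * m)) p m (≤-trans (≤-reflexive (sym h₂≡)) (≤-trans h₂≤n (≤-reflexive (arithmetic m))))
      where
      arithmetic : ∀ m → suc (3 * m) ≡ suc (2 * m) + m
      arithmetic = solve-∀

    q≤m+p : q ≤ m + p
    q≤m+p = +-cancelˡ-≤ (suc m) q (m + p) (≤-trans (≤-reflexive (sym h₁≡)) (≤-trans h₁≤h₂ (≤-reflexive (trans h₂≡ (arithmetic m p)))))
      where
      arithmetic : ∀ m p → suc (2 * m) + p ≡ suc m + (m + p)
      arithmetic = solve-∀

  module _ {Π p q} (dyck : IsDyck n Π) (h₁≡ : h Π 1 ≡ suc m + q) (h₂≡ : h Π 2 ≡ suc (2 * m) + p) where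

    boxes≡ : map proj₂ (rankWord n Π) ≡ word₁ m p q
    boxes≡ = RankWord₁.boxes≡word m p q Π h₁≡ h₂≡

    rankWord-length : n ∸ 1 ≡ length (rankWord n Π)
    rankWord-length = sym (begin
        length (rankWord n Π)
      ≡⟨ sym (length-map proj₂ (rankWord n Π)) ⟩
        length (map proj₂ (rankWord n Π))
      ≡⟨ cong length boxes≡ ⟩
        length (pairs (stepAt p) (stepAt q) 0 m ++ singles (stepAt q) m m)
      ≡⟨ length-++ (pairs (stepAt p) (stepAt q) 0 m) ⟩
        length (pairs (stepAt p) (stepAt q) 0 m) + length (singles (stepAt q) m m)
      ≡⟨ cong₂ _+_ (length-blocks 2 0 m (λ _ → refl)) (length-blocks 1 m m (λ _ → refl)) ⟩
        m * 2 + m * 1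
      ≡⟨ arithmetic m ⟩
        3 * m
      ∎)
      where
      open ≡-Reasoning
      arithmetic : ∀ m → m * 2 + m * 1 ≡ 3 * m
      arithmetic = solve-∀

    area+skip+dinv≡ : ∀ {A r S} → suc (2 * m) + p ≡ suc m + q + A → n ≡ suc (2 * m) + p + r → r ≤ suc m →
      skipWord (word₁ m p q) ≡ S →
      area n Π + skip n Π + dinv n Π ≡ q + p + S + ((legCount (dinvCond n 0) 0 A + legCount (dinvCond n 1) A r) + r)
    area+skip+dinv≡ {A} {r} A≡ r≡ r≤m+1 skip≡S = cong₂ _+_
      (cong₂ _+_ (area≡ {c₁ = suc m} {q} {suc (2 * m)} {p} dyck (m+o≡n⇒m≤n 2 (lower-area₁ m)) (m+o≡n⇒m≤n 0 (upper-area₁ m)) h₁≡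
                             (m+o≡n⇒m≤n 1 (lower-area₂ m)) (m+o≡n⇒m≤n 1 (upper-area₂ m)) h₂≡)
                 (trans (cong skipWord boxes≡) skip≡S))
      (trans (dinv≡ dyck (trans h₂≡ (trans A≡ (cong (_+ A) (sym h₁≡)))) (trans r≡ (cong (_+ r) (sym h₂≡))))
             (cong (legCount (dinvCond n 0) 0 A + legCount (dinvCond n 1) A r +_) (armZero-legs r r≤m+1)))
      where
      lower-area₁ : ∀ m → suc (3 * m) * 1 + 2 ≡ 3 * suc m
      lower-area₁ = solve-∀
      upper-area₁ : ∀ m → suc (3 * suc m) + 0 ≡ 3 + suc (3 * m) * 1
      upper-area₁ = solve-∀
      lower-area₂ : ∀ m → suc (3 * m) * 2 + 1 ≡ 3 * suc (2 * m)
      lower-area₂ = solve-∀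
      upper-area₂ : ∀ m → suc (3 * suc (2 * m)) + 1 ≡ 3 + suc (3 * m) * 2
      upper-area₂ = solve-∀

area+skip+dinv₁ : ∀ {m p q} → Shape₁ m p q → ∀ {Π} → IsDyck (suc (3 * m)) Π → h Π 1 ≡ suc m + q → h Π 2 ≡ suc (2 * m) + p →
  area (suc (3 * m)) Π + skip (suc (3 * m)) Π + dinv (suc (3 * m)) Π ≡ 3 * m
area+skip+dinv₁ (early q d r) {Π} dyck h₁≡ h₂≡ = begin
    area n Π + skip n Π + dinv n Π
  ≡⟨ area+skip+dinv≡ dyck h₁≡ h₂≡ (gap≡ q d r) (n≡ q d r) (m≤n+m r _) (skipWord-early₁ q d r) ⟩
    q + p + d + ((legCount (dinvCond n 0) 0 (suc m + d) + legCount (dinvCond n 1) (suc m + d) r) + r)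
  ≡⟨ cong (λ legs → q + p + d + (legs + r))
       (cong₂ _+_ (armZero-legs-capped d) (armOne-legs (suc m + d) r (≤-trans (n≤1+n m) (m≤m+n (suc m) d)) (legs≤ q d r))) ⟩
    q + p + d + ((suc m + r) + r)
  ≡⟨ total q d r ⟩
    3 * m
  ∎
  where
  open ≡-Reasoning
  m p : ℕ
  m = suc q + d + r
  p = suc q + d
  open Residue₁ m
  gap≡ : ∀ q d r → let m = suc q + d + r in suc (2 * m) + (suc q + d) ≡ suc m + q + (suc m + d)
  gap≡ = solve-∀
  n≡ : ∀ q d r → let m = suc q + d + r in suc (3 * m) ≡ suc (2 * m) + (suc q + d) + r
  n≡ = solve-∀
  legs≤ : ∀ q d r → let m = suc q + d + r in suc m + d + r ≤ suc (2 * m)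
  legs≤ q d r = m+o≡n⇒m≤n (suc q) (arithmetic q d r)
    where
    arithmetic : ∀ q d r → let m = suc q + d + r in suc m + d + r + suc q ≡ suc (2 * m)
    arithmetic = solve-∀
  total : ∀ q d r → let m = suc q + d + r in q + (suc q + d) + d + ((suc m + r) + r) ≡ 3 * m
  total = solve-∀
area+skip+dinv₁ (middle p d r) {Π} dyck h₁≡ h₂≡ = begin
    area n Π + skip n Π + dinv n Π
  ≡⟨ area+skip+dinv≡ dyck h₁≡ h₂≡ (gap≡ p d r) (n≡ p d r) (m+o≡n⇒m≤n (suc p) (r≤ p d r)) (skipWord-middle₁ p d r) ⟩
    q + p + d + ((legCount (dinvCond n 0) 0 (suc p + r) + legCount (dinvCond n 1) (suc p + r) (d + suc r)) + (d + suc r))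
  ≡⟨ cong (λ legs → q + p + d + (legs + (d + suc r)))
       (cong₂ _+_ (armZero-legs (suc p + r) (m+o≡n⇒m≤n (suc d) (A≤ p d r)))
                  (armOne-legs-from (suc p + r) d (suc r) (A+d≡m p d r) (m+o≡n⇒m≤n (suc (p + d)) (legs≤ p d r)))) ⟩
    q + p + d + ((suc p + r + suc r) + (d + suc r))
  ≡⟨ total p d r ⟩
    3 * m
  ∎
  where
  open ≡-Reasoning
  m q : ℕ
  m = suc (p + d) + r
  q = p + d
  open Residue₁ m
  gap≡ : ∀ p d r → let m = suc (p + d) + r in suc (2 * m) + p ≡ suc m + (p + d) + (suc p + r)
  gap≡ = solve-∀
  n≡ : ∀ p d r → let m = suc (p + d) + r in suc (3 * m) ≡ suc (2 * m) + p + (d + suc r)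
  n≡ = solve-∀
  r≤ : ∀ p d r → let m = suc (p + d) + r in d + suc r + suc p ≡ suc m
  r≤ = solve-∀
  A≤ : ∀ p d r → let m = suc (p + d) + r in suc p + r + suc d ≡ suc m
  A≤ = solve-∀
  A+d≡m : ∀ p d r → suc p + r + d ≡ suc (p + d) + r
  A+d≡m = solve-∀
  legs≤ : ∀ p d r → let m = suc (p + d) + r in m + suc r + suc (p + d) ≡ suc (2 * m)
  legs≤ = solve-∀
  total : ∀ p d r → let m = suc (p + d) + r in p + d + p + d + ((suc p + r + suc r) + (d + suc r)) ≡ 3 * m
  total = solve-∀
area+skip+dinv₁ (late d s r) {Π} dyck h₁≡ h₂≡ = begin
    area n Π + skip n Π + dinv n Π
  ≡⟨ area+skip+dinv≡ dyck h₁≡ h₂≡ (gap≡ d s r) (n≡ d s r) (≤-trans (m≤n+m r (d + s)) (n≤1+n m)) (skipWord-late₁ d s r) ⟩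
    q + p + r + ((legCount (dinvCond n 0) 0 s + legCount (dinvCond n 1) s r) + r)
  ≡⟨ cong (λ legs → q + p + r + (legs + r))
       (cong₂ _+_ (armZero-legs s (≤-trans (m≤n+m s d) (≤-trans (m≤m+n (d + s) r) (n≤1+n m))))
                  (armOne-legs-none s r (m+o≡n⇒m≤n d (legs≤ d s r)))) ⟩
    q + p + r + ((s + 0) + r)
  ≡⟨ total d s r ⟩
    3 * m
  ∎
  where
  open ≡-Reasoning
  m p q : ℕ
  m = d + s + r
  p = d + s
  q = d + s + r + d
  open Residue₁ m
  gap≡ : ∀ d s r → let m = d + s + r in suc (2 * m) + (d + s) ≡ suc m + (d + s + r + d) + s
  gap≡ = solve-∀
  n≡ : ∀ d s r → let m = d + s + r in suc (3 * m) ≡ suc (2 * m) + (d + s) + r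
  n≡ = solve-∀
  legs≤ : ∀ d s r → s + r + d ≡ d + s + r
  legs≤ = solve-∀
  total : ∀ d s r → let m = d + s + r in d + s + r + d + (d + s) + r + ((s + 0) + r) ≡ 3 * m
  total = solve-∀

theorem₁ : ∀ m Π → IsDyck (suc (3 * m)) Π →
  (area (suc (3 * m)) Π + skip (suc (3 * m)) Π + dinv (suc (3 * m)) Π ≡ 3 * m) × (3 * m ≡ length (rankWord (suc (3 * m)) Π))
theorem₁ m Π dyck = area+skip+dinv₁ (shape₁ p≤m q≤m+p) dyck h₁≡ h₂≡ , rankWord-length dyck h₁≡ h₂≡
  where
  open Residue₁ m
  open Heights dyck

module Residue₂ (m : ℕ) where

  n : ℕ
  n = suc (suc (3 * m))

  upper : n < 3 * suc m
  upper = m+o≡n⇒m≤n 0 (arithmetic m)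
    where
    arithmetic : ∀ m → suc (suc (suc (3 * m))) + 0 ≡ 3 * suc m
    arithmetic = solve-∀

  open Legs {n} {m} (n≤1+n (suc (3 * m))) upper public

  module Heights {Π} (dyck : IsDyck n Π) where
    open Dyck dyck

    q p : ℕ
    q = h Π 1 ∸ suc m
    p = h Π 2 ∸ suc (suc (2 * m))

    m<h₁ : m < h Π 1
    m<h₁ = *-cancelˡ-< 3 m (h Π 1)
      (≤-trans (n≤1+n (suc (3 * m))) (≤-trans (≤-reflexive (sym (*-identityʳ n))) (column-above 1 z<s (s≤s z≤n))))

    2m+1<h₂ : suc (2 * m) < h Π 2
    2m+1<h₂ = *-cancelˡ-< 3 (suc (2 * m)) (h Π 2) (≤-trans (m+o≡n⇒m≤n 0 (arithmetic m)) (column-above 2 z<s (s≤s (s≤s z≤n))))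
      where
      arithmetic : ∀ m → suc (3 * suc (2 * m)) + 0 ≡ suc (suc (3 * m)) * 2
      arithmetic = solve-∀

    h₁≡ : h Π 1 ≡ suc m + q
    h₁≡ = sym (m+[n∸m]≡n m<h₁)

    h₂≡ : h Π 2 ≡ suc (suc (2 * m)) + p
    h₂≡ = sym (m+[n∸m]≡n 2m+1<h₂)

    p≤m : p ≤ m
    p≤m = +-cancelˡ-≤ (suc (suc (2 * m))) p m (≤-trans (≤-reflexive (sym h₂≡)) (≤-trans h₂≤n (≤-reflexive (arithmetic m))))
      where
      arithmetic : ∀ m → suc (suc (3 * m)) ≡ suc (suc (2 * m)) + m
      arithmetic = solve-∀

    q≤m+p+1 : q ≤ suc (m + p)
    q≤m+p+1 = +-cancelˡ-≤ (suc m) q (suc (m + p))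
      (≤-trans (≤-reflexive (sym h₁≡)) (≤-trans h₁≤h₂ (≤-reflexive (trans h₂≡ (arithmetic m p)))))
      where
      arithmetic : ∀ m p → suc (suc (2 * m)) + p ≡ suc m + suc (m + p)
      arithmetic = solve-∀

  module _ {Π p q} (dyck : IsDyck n Π) (h₁≡ : h Π 1 ≡ suc m + q) (h₂≡ : h Π 2 ≡ suc (suc (2 * m)) + p) where

    boxes≡ : map proj₂ (rankWord n Π) ≡ word₂ m p q
    boxes≡ = RankWord₂.boxes≡word m p q Π h₁≡ h₂≡

    rankWord-length : n ∸ 1 ≡ length (rankWord n Π)
    rankWord-length = sym (begin
        length (rankWord n Π)
      ≡⟨ sym (length-map proj₂ (rankWord n Π)) ⟩
        length (map proj₂ (rankWord n Π))
      ≡⟨ cong length boxes≡ ⟩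
        length (pairs (stepAt q) (stepAt p) 0 m ++ singles (stepAt q) m (suc m))
      ≡⟨ length-++ (pairs (stepAt q) (stepAt p) 0 m) ⟩
        length (pairs (stepAt q) (stepAt p) 0 m) + length (singles (stepAt q) m (suc m))
      ≡⟨ cong₂ _+_ (length-blocks 2 0 m (λ _ → refl)) (length-blocks {B = λ i → stepAt q i ∷ []} 1 m (suc m) (λ _ → refl)) ⟩
        m * 2 + suc m * 1
      ≡⟨ arithmetic m ⟩
        suc (3 * m)
      ∎)
      where
      open ≡-Reasoning
      arithmetic : ∀ m → m * 2 + suc m * 1 ≡ suc (3 * m)
      arithmetic = solve-∀

    area+skip+dinv≡ : ∀ {A r S} → suc (suc (2 * m)) + p ≡ suc m + q + A → n ≡ suc (suc (2 * m)) + p + r → r ≤ suc m →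
      skipWord (word₂ m p q) ≡ S →
      area n Π + skip n Π + dinv n Π ≡ q + p + S + ((legCount (dinvCond n 0) 0 A + legCount (dinvCond n 1) A r) + r)
    area+skip+dinv≡ {A} {r} A≡ r≡ r≤m+1 skip≡S = cong₂ _+_
      (cong₂ _+_ (area≡ {c₁ = suc m} {q} {suc (suc (2 * m))} {p} dyck
                             (m+o≡n⇒m≤n 1 (lower-area₁ m)) (m+o≡n⇒m≤n 1 (upper-area₁ m)) h₁≡
                             (m+o≡n⇒m≤n 2 (lower-area₂ m)) (m+o≡n⇒m≤n 0 (upper-area₂ m)) h₂≡)
                 (trans (cong skipWord boxes≡) skip≡S))
      (trans (dinv≡ dyck (trans h₂≡ (trans A≡ (cong (_+ A) (sym h₁≡)))) (trans r≡ (cong (_+ r) (sym h₂≡))))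
             (cong (legCount (dinvCond n 0) 0 A + legCount (dinvCond n 1) A r +_) (armZero-legs r r≤m+1)))
      where
      lower-area₁ : ∀ m → suc (suc (3 * m)) * 1 + 1 ≡ 3 * suc m
      lower-area₁ = solve-∀
      upper-area₁ : ∀ m → suc (3 * suc m) + 1 ≡ 3 + suc (suc (3 * m)) * 1
      upper-area₁ = solve-∀
      lower-area₂ : ∀ m → suc (suc (3 * m)) * 2 + 2 ≡ 3 * suc (suc (2 * m))
      lower-area₂ = solve-∀
      upper-area₂ : ∀ m → suc (3 * suc (suc (2 * m))) + 0 ≡ 3 + suc (suc (3 * m)) * 2
      upper-area₂ = solve-∀

area+skip+dinv₂ : ∀ {m p q} → Shape₂ m p q → ∀ {Π} → IsDyck (suc (suc (3 * m))) Π →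
  h Π 1 ≡ suc m + q → h Π 2 ≡ suc (suc (2 * m)) + p →
  area (suc (suc (3 * m))) Π + skip (suc (suc (3 * m))) Π + dinv (suc (suc (3 * m))) Π ≡ suc (3 * m)
area+skip+dinv₂ (early q d r) {Π} dyck h₁≡ h₂≡ = begin
    area n Π + skip n Π + dinv n Π
  ≡⟨ area+skip+dinv≡ dyck h₁≡ h₂≡ (gap≡ q d r) (n≡ q d r) (≤-trans (m≤n+m r (q + d)) (n≤1+n m)) (skipWord-early₂ q d r) ⟩
    q + p + d + ((legCount (dinvCond n 0) 0 (suc m + d) + legCount (dinvCond n 1) (suc m + d) r) + r)
  ≡⟨ cong (λ legs → q + p + d + (legs + r))
       (cong₂ _+_ (armZero-legs-capped d)
                  (armOne-legs (suc m + d) r (≤-trans (n≤1+n m) (m≤m+n (suc m) d)) (m+o≡n⇒m≤n q (legs≤ q d r)))) ⟩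
    q + p + d + ((suc m + r) + r)
  ≡⟨ total q d r ⟩
    suc (3 * m)
  ∎
  where
  open ≡-Reasoning
  m p : ℕ
  m = q + d + r
  p = q + d
  open Residue₂ m
  gap≡ : ∀ q d r → let m = q + d + r in suc (suc (2 * m)) + (q + d) ≡ suc m + q + (suc m + d)
  gap≡ = solve-∀
  n≡ : ∀ q d r → let m = q + d + r in suc (suc (3 * m)) ≡ suc (suc (2 * m)) + (q + d) + r
  n≡ = solve-∀
  legs≤ : ∀ q d r → let m = q + d + r in suc m + d + r + q ≡ suc (2 * m)
  legs≤ = solve-∀
  total : ∀ q d r → let m = q + d + r in q + (q + d) + d + ((suc m + r) + r) ≡ suc (3 * m)
  total = solve-∀
area+skip+dinv₂ (middle p d r) {Π} dyck h₁≡ h₂≡ = begin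
    area n Π + skip n Π + dinv n Π
  ≡⟨ area+skip+dinv≡ dyck h₁≡ h₂≡ (gap≡ p d r) (n≡ p d r) (m+o≡n⇒m≤n (suc p) (r≤ p d r)) (skipWord-middle₂ p d r) ⟩
    q + p + d + ((legCount (dinvCond n 0) 0 (suc p + r) + legCount (dinvCond n 1) (suc p + r) (d + suc r)) + (d + suc r))
  ≡⟨ cong (λ legs → q + p + d + (legs + (d + suc r)))
       (cong₂ _+_ (armZero-legs (suc p + r) (m+o≡n⇒m≤n (suc d) (A≤ p d r)))
                  (armOne-legs-from (suc p + r) d (suc r) (A+d≡m p d r) (m+o≡n⇒m≤n (suc p + d) (legs≤ p d r)))) ⟩
    q + p + d + ((suc p + r + suc r) + (d + suc r))
  ≡⟨ total p d r ⟩
    suc (3 * m)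
  ∎
  where
  open ≡-Reasoning
  m q : ℕ
  m = suc p + d + r
  q = suc p + d
  open Residue₂ m
  gap≡ : ∀ p d r → let m = suc p + d + r in suc (suc (2 * m)) + p ≡ suc m + (suc p + d) + (suc p + r)
  gap≡ = solve-∀
  n≡ : ∀ p d r → let m = suc p + d + r in suc (suc (3 * m)) ≡ suc (suc (2 * m)) + p + (d + suc r)
  n≡ = solve-∀
  r≤ : ∀ p d r → let m = suc p + d + r in d + suc r + suc p ≡ suc m
  r≤ = solve-∀
  A≤ : ∀ p d r → let m = suc p + d + r in suc p + r + suc d ≡ suc m
  A≤ = solve-∀
  A+d≡m : ∀ p d r → suc p + r + d ≡ suc p + d + r
  A+d≡m = solve-∀
  legs≤ : ∀ p d r → let m = suc p + d + r in m + suc r + (suc p + d) ≡ suc (2 * m)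
  legs≤ = solve-∀
  total : ∀ p d r → let m = suc p + d + r in suc p + d + p + d + ((suc p + r + suc r) + (d + suc r)) ≡ suc (3 * m)
  total = solve-∀
area+skip+dinv₂ (late d s r) {Π} dyck h₁≡ h₂≡ = begin
    area n Π + skip n Π + dinv n Π
  ≡⟨ area+skip+dinv≡ dyck h₁≡ h₂≡ (gap≡ d s r) (n≡ d s r) (≤-trans (m≤n+m r (d + s)) (n≤1+n m)) (skipWord-late₂ d s r) ⟩
    q + p + r + ((legCount (dinvCond n 0) 0 s + legCount (dinvCond n 1) s r) + r)
  ≡⟨ cong (λ legs → q + p + r + (legs + r))
       (cong₂ _+_ (armZero-legs s (≤-trans (m≤n+m s d) (≤-trans (m≤m+n (d + s) r) (n≤1+n m))))
                  (armOne-legs-none s r (m+o≡n⇒m≤n d (legs≤ d s r)))) ⟩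
    q + p + r + ((s + 0) + r)
  ≡⟨ total d s r ⟩
    suc (3 * m)
  ∎
  where
  open ≡-Reasoning
  m p q : ℕ
  m = d + s + r
  p = d + s
  q = suc (d + s + r) + d
  open Residue₂ m
  gap≡ : ∀ d s r → let m = d + s + r in suc (suc (2 * m)) + (d + s) ≡ suc m + (suc (d + s + r) + d) + s
  gap≡ = solve-∀
  n≡ : ∀ d s r → let m = d + s + r in suc (suc (3 * m)) ≡ suc (suc (2 * m)) + (d + s) + r
  n≡ = solve-∀
  legs≤ : ∀ d s r → s + r + d ≡ d + s + r
  legs≤ = solve-∀
  total : ∀ d s r → let m = d + s + r in suc (d + s + r) + d + (d + s) + r + ((s + 0) + r) ≡ suc (3 * m)
  total = solve-∀

theorem₂ : ∀ m Π → IsDyck (suc (suc (3 * m))) Π →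
  (area (suc (suc (3 * m))) Π + skip (suc (suc (3 * m))) Π + dinv (suc (suc (3 * m))) Π ≡ suc (3 * m))
  × (suc (3 * m) ≡ length (rankWord (suc (suc (3 * m))) Π))
theorem₂ m Π dyck = area+skip+dinv₂ (shape₂ p≤m q≤m+p+1) dyck h₁≡ h₂≡ , rankWord-length dyck h₁≡ h₂≡
  where
  open Residue₂ m
  open Heights dyck

data Residue : ℕ → Set where
  one : ∀ m → Residue (suc (3 * m))
  two : ∀ m → Residue (suc (suc (3 * m)))

residue : ∀ n → ¬ 3 ∣ n → Residue n
residue n 3∤n = fromDivMod n (n % 3) (n / 3) (m≡m%n+[m/n]*n n 3) (m%n<n n 3) (λ n%3≡0 → 3∤n (m%n≡0⇒n∣m n 3 n%3≡0))
  where
  fromDivMod : ∀ n ρ k → n ≡ ρ + k * 3 → ρ < 3 → ρ ≢ 0 → Residue n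
  fromDivMod _ 0             k _    _ ρ≢0 = ⊥-elim (ρ≢0 refl)
  fromDivMod _ 1             k refl _ _   = subst (λ x → Residue (suc x)) (*-comm 3 k) (one k)
  fromDivMod _ 2             k refl _ _   = subst (λ x → Residue (suc (suc x))) (*-comm 3 k) (two k)
  fromDivMod _ (suc (suc (suc ρ))) _ _ (s≤s (s≤s (s≤s ()))) _

mainTheorem6 : (n : ℕ) → 1 ≤ n → ¬ (3 ∣ n) → (Π : List Step) → IsDyck n Π →
    (area n Π + skip n Π + dinv n Π ≡ n ∸ 1)
    × (n ∸ 1 ≡ length (rankWord n Π))
mainTheorem6 n _ 3∤n Π dyck with residue n 3∤n
... | one m = theorem₁ m Π dyck
... | two m = theorem₂ m Π dyck
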